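{- Let $n\geq k\geq l\geq 1$ be integers. Let $\Gamma_{k,l}$ be the set of families $\gamma=(\gamma_i)_{i\in[n]\setminus\{k\}}$ of pairwise disjoint lattice paths such that $\gamma_i$ goes from $A_i$ to $B_i$ for $1\leq i<l$ and for $k<i\leq n$, and $\gamma_i$ goes from $A_{i+1}$ to $B_i$ for $l\leq i<k$, where $A_i=(i-1,2i-1)$ and $B_i=(2i-1,2i-1)$. Then $$c_{k,l}(q)=\sum_{\gamma\in\Gamma_{k,l}}\psi(\gamma).$$
   Context: For $m\in\mathbb Z$ and $r\in\mathbb N$, $(x;q)_r=(1-x)(1-xq)\cdots(1-xq^{r-1})$ and ${m\brack r}_q=\frac{(q^{m-r+1};q)_r}{(q;q)_r}$; entries with negative lower index are $0$. Let $G_q$ be the (lower unitriangular) infinite matrix $G_q=\left({i\brack 2i-2j}_q\,q^{(i-j-1)(i-j)}\right)_{i,j\geq 1}$ and write its inverse as $G_q^{ -1}=((-1)^{i-j}c_{i,j}(q))_{i,j\geq 1}$. A lattice path from $(a,b)$ to $(c,d)$ is a sequence of integer points starting at $(a,b)$ and ending at $(c,d)$ in which each step is either $(1,0)$ or $(0,-1)$. For such a path $w$, let $|\lambda_w|=\sum (x-a)$, the sum over all steps $(0,-1)$ of $w$, $x$ being the abscissa of that step. Two paths are disjoint if they have no common point. For a family $\gamma=(\gamma_i)$ of paths, $\psi(\gamma)=q^{\sum_i|\lambda_{\gamma_i}|}$. -}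

module Defs where

open import Level using (Level)
open import Algebra.Bundles using (CommutativeRing)
import Data.Nat.ListAction
open import Data.Nat as ℕ using (ℕ; zero; suc; _∸_; _≤ᵇ_; _≡ᵇ_)
open import Data.Integer as ℤ using (ℤ; +_)
open import Data.Product using (_×_; _,_; proj₁; proj₂)
open import Data.Product.Properties using (≡-dec)
open import Data.List using (List; []; _∷_; map; filterᵇ; upTo)
open import Data.List.Membership.Propositional using (_∈_)
open import Data.List.Relation.Binary.Pointwise using (Pointwise)
open import Data.List.Relation.Unary.AllPairs using (AllPairs)
open import Data.Bool using (if_then_else_; not)
open import Data.Empty using (⊥)
open import Relation.Nullary.Decidable using (does)
open import Relation.Binary.PropositionalEquality using (_≡_)

Point : Set
Point = ℤ × ℤ

data IsPath : Point → Point → List Point → Set where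
  stop  : ∀ p → IsPath p p (p ∷ [])
  right : ∀ {x y t w} → IsPath (x ℤ.+ ℤ.1ℤ , y) t w →
          IsPath (x , y) t ((x , y) ∷ w)
  down  : ∀ {x y t w} → IsPath (x , y ℤ.- ℤ.1ℤ) t w →
          IsPath (x , y) t ((x , y) ∷ w)

Disjoint : List Point → List Point → Set
Disjoint v w = ∀ p → p ∈ v → p ∈ w → ⊥

_≟P_ : (p p' : Point) → _
_≟P_ = ≡-dec ℤ._≟_ ℤ._≟_

lamAux : ℤ → List Point → ℤ
lamAux a [] = ℤ.0ℤ
lamAux a (p ∷ []) = ℤ.0ℤ
lamAux a ((x , y) ∷ p' ∷ w) =
  (if does (p' ≟P (x , y ℤ.- ℤ.1ℤ)) then x ℤ.- a else ℤ.0ℤ) ℤ.+ lamAux a (p' ∷ w)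

-- |λ_w| (a natural number for a genuine path; absolute value taken
-- only to land in ℕ for use as an exponent)
lam : List Point → ℕ
lam [] = 0
lam ((a , b) ∷ w) = ℤ.∣ lamAux a ((a , b) ∷ w) ∣

A B : ℕ → Point
A i = (+ (i ∸ 1) , + (2 ℕ.* i ∸ 1))
B i = (+ (2 ℕ.* i ∸ 1) , + (2 ℕ.* i ∸ 1))

indices : ℕ → ℕ → List ℕ
indices n k = filterᵇ (λ i → not (i ≡ᵇ k)) (map suc (upTo n))

src : ℕ → ℕ → ℕ → Point
src k l i = if (l ≤ᵇ i) Data.Bool.∧ not (k ≤ᵇ i) then A (suc i) else A i

-- γ ∈ Γ_{k,l}: γ lists (γ_i) for i ∈ [n]\{k} in increasing order of i
InΓ : ℕ → ℕ → ℕ → List (List Point) → Set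
InΓ n k l γ =
  Pointwise (λ i w → IsPath (src k l i) (B i) w) (indices n k) γ
  Data.Product.× AllPairs Disjoint γ

module WithRing {c ℓ : Level} (R : CommutativeRing c ℓ) where
  open CommutativeRing R

  pow : Carrier → ℕ → Carrier
  pow x zero = 1#
  pow x (suc n) = x * pow x n

  qbin : Carrier → ℕ → ℕ → Carrier
  qbin q m zero = 1#
  qbin q zero (suc r) = 0#
  qbin q (suc m) (suc r) = qbin q m r + pow q (suc r) * qbin q m (suc r)

  G : Carrier → ℕ → ℕ → Carrier
  G q i j = if j ≤ᵇ i
            then qbin q i (2 ℕ.* (i ∸ j)) * pow q (((i ∸ j) ∸ 1) ℕ.* (i ∸ j))
            else 0#

  sumTo : (ℕ → Carrier) → ℕ → Carrier
  sumTo f zero = 0#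
  sumTo f (suc i) = sumTo f i + f (suc i)

  δ : ℕ → ℕ → Carrier
  δ i j = if i ≡ᵇ j then 1# else 0#

  -- H is the inverse of G_q:  (G_q H)_{i,j} = δ_{i,j} for all i, j ≥ 1
  -- (since G_q is lower triangular, (G_q H)_{i,j} = Σ_{m=1}^{i} G_{i,m} H_{m,j};
  --  G_q being lower unitriangular, this H is unique and equals G_q^{-1})
  IsInverseG : Carrier → (ℕ → ℕ → Carrier) → Set ℓ
  IsInverseG q H = ∀ i j → 1 ℕ.≤ i → 1 ℕ.≤ j →
                   sumTo (λ m → G q i m * H m j) i ≈ δ i j

  signed : ℕ → Carrier → Carrier
  signed zero x = x
  signed (suc d) x = - signed d x

  sumList : List Carrier → Carrier
  sumList [] = 0#
  sumList (x ∷ xs) = x + sumList xs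

  ψ : Carrier → List (List Point) → Carrier
  ψ q γ = pow q (Data.Nat.ListAction.sum (map lam γ))

{-# OPTIONS --safe #-}
-- For i < l and i > k the path γ_i runs from A_i to B_i inside one row, so it is forced.
-- For l ≤ i < k it runs from A_{i+1} to B_i, two rows lower, so it is determined by the
-- numbers a_i ≤ b_i < i of right steps taken before its two down steps, and then
-- |λ_{γ_i}| = a_i + b_i.  Only consecutive paths can meet, and γ_i , γ_{i+1} meet iff
-- b_{i+1} < a_i.  Hence the right-hand side is the weight F_{k-l} of the sequences with
-- a_i ≤ b_{i+1}.  Inclusion–exclusion over these constraints, grouping the last block of
-- violated ones, gives F_{p+1} = Σ_{t ≤ p} (-1)^{p-t} G_{l+p+1,l+t} F_t: a block of s + 1
-- pairs below N forms a chain a ≤ b < a′ ≤ b′ < ⋯ < N, and such chains have weight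
-- q^{s(s+1)} [N+s+1 choose 2s+2] = G_{N+s+1,N}.  This recursion says that
-- m ↦ (-1)^{m-l} F_{m-l} solves the unitriangular system G_q x = e_l, so it is the l-th
-- column of G_q^{-1}.
module Submission where

open import Defs
open import Algebra.Bundles using (CommutativeRing)
open import Data.Nat using (ℕ; _≤_; _∸_)
open import Data.List using (List; map)
open import Data.List.Membership.Propositional using (_∈_)
open import Data.List.Relation.Unary.Unique.Propositional using (Unique)
open import Function.Bundles using (_⇔_)

open import Level using (Level)
open import Data.Nat as ℕ using (zero; suc; _<_; _≤ᵇ_; _≡ᵇ_; _≤′_; z≤n; s≤s)
import Data.Nat.Properties as ℕₚ
open import Data.Nat.ListAction using (sum)
open import Data.Nat.ListAction.Properties using (sum-++)
open import Data.Nat.Tactic.RingSolver using (solve-∀)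
import Data.Integer as ℤ
import Data.Integer.Properties as ℤₚ
open import Data.Bool using (Bool; true; false; not; T; if_then_else_)
open import Data.Unit using (⊤; tt)
open import Data.Empty using (⊥; ⊥-elim)
open import Data.Fin using (toℕ)
open import Data.Fin.Properties using (toℕ<n; toℕ-inject₁; toℕ-fromℕ)
open import Data.Product using (Σ-syntax; ∃-syntax; _×_; _,_; proj₁; proj₂; uncurry)
open import Data.Sum using (_⊎_; inj₁; inj₂)
open import Data.List using ([]; _∷_; _++_; _∷ʳ_; length; replicate; applyUpTo; upTo; concatMap; foldr; filterᵇ)
import Data.List.Properties as Listₚ
open import Data.List.Membership.Propositional using (find; lose)
open import Data.List.Membership.Propositional.Properties
  using (∈-map⁺; ∈-map⁻; ∈-concatMap⁺; ∈-concatMap⁻; ∈-upTo⁺; ∈-upTo⁻; ∈-applyUpTo⁻)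
open import Data.List.Membership.Propositional.Properties.WithK using (unique∧set⇒bag)
open import Data.List.Relation.Unary.Any using (here; there)
open import Data.List.Relation.Unary.All as All using (All; []; _∷_)
import Data.List.Relation.Unary.All.Properties as Allₚ
open import Data.List.Relation.Unary.AllPairs as AllPairs using (AllPairs; []; _∷_)
import Data.List.Relation.Unary.AllPairs.Properties as AllPairsₚ
import Data.List.Relation.Unary.Unique.Propositional.Properties as Uniqueₚ
open import Data.List.Relation.Binary.Pointwise using (Pointwise; []; _∷_)
open import Data.List.Relation.Binary.Permutation.Propositional using (_↭_; ↭⇒↭ₛ′)
import Data.List.Relation.Binary.Permutation.Propositional.Properties as Permutationₚ
import Data.List.Relation.Binary.Permutation.Setoid.Properties as SetoidPermutationₚ
open import Data.List.Relation.Binary.BagAndSetEquality using (∼bag⇒↭)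
open import Function.Bundles using (mk⇔; Equivalence)
open import Relation.Nullary using (¬_; Dec)
open import Relation.Nullary.Decidable using (T?; dec-true; dec-false)
open import Relation.Binary.PropositionalEquality as ≡ using (_≡_; _≢_)

≤ᵇ-yes : ∀ {m n} → m ≤ n → (m ≤ᵇ n) ≡ true
≤ᵇ-yes {m} {n} = dec-true (m ℕₚ.≤? n)

≤ᵇ-no : ∀ {m n} → n < m → (m ≤ᵇ n) ≡ false
≤ᵇ-no {m} {n} n<m = dec-false (m ℕₚ.≤? n) (ℕₚ.<⇒≱ n<m)

≡ᵇ-yes : ∀ {m n} → m ≡ n → (m ≡ᵇ n) ≡ true
≡ᵇ-yes {m} {n} = dec-true (m ℕₚ.≟ n)

≡ᵇ-no : ∀ {m n} → m ≢ n → (m ≡ᵇ n) ≡ false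
≡ᵇ-no {m} {n} = dec-false (m ℕₚ.≟ n)

applyUpTo-cong : ∀ {A : Set} {f g : ℕ → A} n → (∀ i → f i ≡ g i) → applyUpTo f n ≡ applyUpTo g n
applyUpTo-cong zero f≗g = ≡.refl
applyUpTo-cong (suc n) f≗g = ≡.cong₂ _∷_ (f≗g 0) (applyUpTo-cong n (λ i → f≗g (suc i)))

applyUpTo-++ : ∀ {A : Set} (f : ℕ → A) a b → applyUpTo f (a ℕ.+ b) ≡ applyUpTo f a ++ applyUpTo (λ i → f (a ℕ.+ i)) b
applyUpTo-++ f zero b = ≡.refl
applyUpTo-++ f (suc a) b = ≡.cong (f 0 ∷_) (applyUpTo-++ (λ i → f (suc i)) a b)

Pointwise-map⁺ : ∀ {A B C : Set} {R : B → C → Set} (f : A → B) (g : A → C) {xs} →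
                 All (λ x → R (f x) (g x)) xs → Pointwise R (map f xs) (map g xs)
Pointwise-map⁺ f g [] = []
Pointwise-map⁺ f g (r ∷ rs) = r ∷ Pointwise-map⁺ f g rs

Pointwise-++⁻ : ∀ {A B : Set} {R : A → B → Set} xs ys {zs} → Pointwise R (xs ++ ys) zs →
                Σ[ zs₁ ∈ List B ] Σ[ zs₂ ∈ List B ] zs ≡ zs₁ ++ zs₂ × Pointwise R xs zs₁ × Pointwise R ys zs₂
Pointwise-++⁻ [] ys rs = [] , _ , ≡.refl , [] , rs
Pointwise-++⁻ (x ∷ xs) ys (r ∷ rs) with Pointwise-++⁻ xs ys rs
... | zs₁ , zs₂ , ≡.refl , rs₁ , rs₂ = _ ∷ zs₁ , zs₂ , ≡.refl , r ∷ rs₁ , rs₂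

Pointwise-functional : ∀ {A B : Set} {R : A → B → Set} (f : A → B) {xs ys} → Pointwise R xs ys →
                       (∀ {x y} → x ∈ xs → R x y → y ≡ f x) → ys ≡ map f xs
Pointwise-functional f [] _ = ≡.refl
Pointwise-functional f (r ∷ rs) R⇒≡ = ≡.cong₂ _∷_ (R⇒≡ (here ≡.refl) r)
    (Pointwise-functional f rs (λ x∈ → R⇒≡ (there x∈)))

AllPairs-++⁻ : ∀ {A : Set} {R : A → A → Set} xs {ys} → AllPairs R (xs ++ ys) →
               AllPairs R xs × AllPairs R ys × All (λ x → All (R x) ys) xs
AllPairs-++⁻ [] rs = [] , rs , []
AllPairs-++⁻ (x ∷ xs) (r ∷ rs) with AllPairs-++⁻ xs rs
... | rs₁ , rs₂ , cross = Allₚ.++⁻ˡ xs r ∷ rs₁ , rs₂ , Allₚ.++⁻ʳ xs r ∷ cross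

onlyIf : ∀ {A : Set} → Bool → List A → List A
onlyIf b xs = if b then xs else []

∈-onlyIf⁻ : ∀ {A : Set} b {xs : List A} {y} → y ∈ onlyIf b xs → T b × y ∈ xs
∈-onlyIf⁻ true y∈ = tt , y∈

∈-onlyIf⁺ : ∀ {A : Set} {b} {xs : List A} {y} → T b → y ∈ xs → y ∈ onlyIf b xs
∈-onlyIf⁺ {b = true} _ y∈ = y∈

onlyIf-unique : ∀ {A : Set} b {xs : List A} → Unique xs → Unique (onlyIf b xs)
onlyIf-unique true u = u
onlyIf-unique false u = []

∈-concatMap⁻′ : ∀ {A B : Set} (f : A → List B) xs {y} → y ∈ concatMap f xs → Σ[ x ∈ A ] x ∈ xs × y ∈ f x
∈-concatMap⁻′ f xs y∈ = find (∈-concatMap⁻ f y∈)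

concatMap-unique : ∀ {A B : Set} (f : A → List B) (key : B → A) {xs} → Unique xs → (∀ x → Unique (f x)) →
                   (∀ x {y} → y ∈ f x → key y ≡ x) → Unique (concatMap f xs)
concatMap-unique f key {xs} u uf keyed = Uniqueₚ.concat⁺ (All.tabulate (λ {ys} ys∈ → unique-block ys∈))
  (AllPairsₚ.map⁺ (AllPairs.map (λ x≢x′ {_} (y∈ , y∈′) → x≢x′
        (≡.trans (≡.sym (keyed _ y∈)) (keyed _ y∈′))) u))
  where
  unique-block : ∀ {ys} → ys ∈ map f xs → Unique ys
  unique-block ys∈ with ∈-map⁻ f ys∈
  ... | x , _ , ≡.refl = uf x

map-unique-on : ∀ {A B : Set} (f : A → B) {xs} → Unique xs → (∀ {x y} → x ∈ xs → y ∈ xs → f x ≡ f y → x ≡ y) →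
                Unique (map f xs)
map-unique-on f [] _ = []
map-unique-on f (x∉ ∷ u) injective-on =
  All.tabulate distinct ∷ map-unique-on f u (λ x∈ y∈ → injective-on (there x∈) (there y∈))
  where
  distinct : ∀ {z} → z ∈ map f _ → f _ ≢ z
  distinct z∈ fx≡z with ∈-map⁻ f z∈
  ... | y , y∈ , ≡.refl = All.lookup x∉ y∈ (injective-on (here ≡.refl) (there y∈) fx≡z)

module Summation {c ℓ : Level} (R : CommutativeRing c ℓ) where
  open CommutativeRing R hiding (zero)
  open WithRing R using (signed; pow; sumList)
  import Algebra.Properties.Semiring.Sum semiring as FinSum
  open import Algebra.Properties.Ring ring using (-1*x≈-x; -‿distribˡ-*; -‿distribʳ-*; -‿involutive)
  open import Algebra.Properties.CommutativeSemigroup *-commutativeSemigroup using (x∙yz≈y∙xz)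
  import Algebra.Properties.Semiring.Exp semiring as Exp
  open import Relation.Binary.Reasoning.Setoid setoid

  -- Opaque, because unfolded ∑ N f is a fold over Fin N from which unification cannot
  -- recover f.
  opaque
    ∑ : ℕ → (ℕ → Carrier) → Carrier
    ∑ N f = FinSum.sum {N} (λ i → f (toℕ i))

    ∑-cong : ∀ N {f g : ℕ → Carrier} → (∀ x → x < N → f x ≈ g x) → ∑ N f ≈ ∑ N g
    ∑-cong N f≈g = FinSum.sum-cong-≋ (λ i → f≈g (toℕ i) (toℕ<n i))

    ∑-zero : ∀ N {f : ℕ → Carrier} → (∀ x → x < N → f x ≈ 0#) → ∑ N f ≈ 0#
    ∑-zero N f≈0 = trans (∑-cong N f≈0) (FinSum.sum-replicate-zero N)

    ∑-+ : ∀ N (f g : ℕ → Carrier) → ∑ N (λ x → f x + g x) ≈ ∑ N f + ∑ N g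
    ∑-+ N f g = FinSum.∑-distrib-+ {N} (λ i → f (toℕ i)) (λ i → g (toℕ i))

    ∑-*ˡ : ∀ N a (f : ℕ → Carrier) → ∑ N (λ x → a * f x) ≈ a * ∑ N f
    ∑-*ˡ N a f = sym (FinSum.*-distribˡ-sum {N} a (λ i → f (toℕ i)))

    ∑-*ʳ : ∀ N a (f : ℕ → Carrier) → ∑ N (λ x → f x * a) ≈ ∑ N f * a
    ∑-*ʳ N a f = sym (FinSum.*-distribʳ-sum {N} a (λ i → f (toℕ i)))

    ∑-swap : ∀ N M (f : ℕ → ℕ → Carrier) → ∑ N (λ x → ∑ M (f x)) ≈ ∑ M (λ y → ∑ N (λ x → f x y))
    ∑-swap N M f = FinSum.∑-comm {N} {M} (λ i j → f (toℕ i) (toℕ j))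

    ∑≡sumList : ∀ N (f : ℕ → Carrier) → ∑ N f ≡ sumList (applyUpTo f N)
    ∑≡sumList zero f = ≡.refl
    ∑≡sumList (suc N) f = ≡.cong (f 0 +_) (∑≡sumList N (λ i → f (suc i)))

    ∑-empty : ∀ (f : ℕ → Carrier) → ∑ 0 f ≈ 0#
    ∑-empty f = refl

    ∑-one : ∀ (f : ℕ → Carrier) → ∑ 1 f ≈ f 0
    ∑-one f = +-identityʳ (f 0)

    ∑-last : ∀ N (f : ℕ → Carrier) → ∑ (suc N) f ≈ ∑ N f + f N
    ∑-last N f = trans (FinSum.sum-init-last {N} (λ i → f (toℕ i)))
      (+-cong (reflexive (FinSum.sum-cong-≗ {N} (λ i → ≡.cong f (toℕ-inject₁ i))))
              (reflexive (≡.cong f (toℕ-fromℕ N))))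

  ∑-truncate : ∀ {N M} {f : ℕ → Carrier} → N ≤ M → (∀ x → N ≤ x → f x ≈ 0#) → ∑ M f ≈ ∑ N f
  ∑-truncate {N} {f = f} N≤M f≈0 = go (ℕₚ.≤⇒≤′ N≤M)
    where
    go : ∀ {M} → N ≤′ M → ∑ M f ≈ ∑ N f
    go (ℕ.≤′-reflexive ≡.refl) = refl
    go {suc M} (ℕ.≤′-step N≤′M) = begin
      ∑ (suc M) f  ≈⟨ ∑-last M f ⟩
      ∑ M f + f M  ≈⟨ +-cong (go N≤′M) (f≈0 M (ℕₚ.≤′⇒≤ N≤′M)) ⟩
      ∑ N f + 0#   ≈⟨ +-identityʳ _ ⟩
      ∑ N f        ∎


  ∑-*-truncate : ∀ {N M} (k f : ℕ → Carrier) → N ≤ M → (∀ x → N ≤ x → f x ≈ 0#) →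
                 ∑ M (λ x → k x * f x) ≈ ∑ N (λ x → k x * f x)
  ∑-*-truncate k f N≤M f≈0 = ∑-truncate N≤M (λ x N≤x → trans (*-congˡ (f≈0 x N≤x)) (zeroʳ (k x)))

  ∑-neg : ∀ N (f : ℕ → Carrier) → ∑ N (λ x → - f x) ≈ - ∑ N f
  ∑-neg N f = begin
    ∑ N (λ x → - f x)       ≈⟨ ∑-cong N (λ x _ → sym (-1*x≈-x (f x))) ⟩
    ∑ N (λ x → - 1# * f x)  ≈⟨ ∑-*ˡ N (- 1#) f ⟩
    - 1# * ∑ N f            ≈⟨ -1*x≈-x _ ⟩
    - ∑ N f                 ∎

  ∑-interchange : ∀ N M (k c : ℕ → Carrier) (g : ℕ → ℕ → Carrier) →
                  ∑ N (λ x → k x * ∑ M (λ t → c t * g t x)) ≈ ∑ M (λ t → c t * ∑ N (λ x → k x * g t x))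
  ∑-interchange N M k c g = begin
    ∑ N (λ x → k x * ∑ M (λ t → c t * g t x))
      ≈⟨ ∑-cong N (λ x _ → trans (sym (∑-*ˡ M (k x) _)) (∑-cong M (λ t _ → x∙yz≈y∙xz (k x) (c t) (g t x)))) ⟩
    ∑ N (λ x → ∑ M (λ t → c t * (k x * g t x)))  ≈⟨ ∑-swap N M _ ⟩
    ∑ M (λ t → ∑ N (λ x → c t * (k x * g t x)))  ≈⟨ ∑-cong M (λ t _ → ∑-*ˡ N (c t) _) ⟩
    ∑ M (λ t → c t * ∑ N (λ x → k x * g t x))    ∎

  ∑-affine : ∀ N M (k c : ℕ → Carrier) (g : ℕ → ℕ → Carrier) e →
             ∑ N (λ x → k x * (e - ∑ M (λ t → c t * g t x))) ≈
             ∑ N k * e - ∑ M (λ t → c t * ∑ N (λ x → k x * g t x))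
  ∑-affine N M k c g e = begin
    ∑ N (λ x → k x * (e - ∑ M (λ t → c t * g t x)))
      ≈⟨ ∑-cong N (λ x _ → trans (distribˡ (k x) e _) (+-congˡ (sym (-‿distribʳ-* (k x) _)))) ⟩
    ∑ N (λ x → k x * e + - (k x * ∑ M (λ t → c t * g t x)))
      ≈⟨ trans (∑-+ N _ _) (+-cong (∑-*ʳ N e k) (∑-neg N _)) ⟩
    ∑ N k * e - ∑ N (λ x → k x * ∑ M (λ t → c t * g t x))
      ≈⟨ +-congˡ (-‿cong (∑-interchange N M k c g)) ⟩
    ∑ N k * e - ∑ M (λ t → c t * ∑ N (λ x → k x * g t x)) ∎

  ⟦_⟧ : Bool → Carrier
  ⟦ true ⟧ = 1#
  ⟦ false ⟧ = 0#

  ⟦≤ᵇ⟧*-yes : ∀ {m n} x → m ≤ n → ⟦ m ≤ᵇ n ⟧ * x ≈ x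
  ⟦≤ᵇ⟧*-yes x m≤n rewrite ≤ᵇ-yes m≤n = *-identityˡ x

  ⟦≤ᵇ⟧*-no : ∀ {m n} x → n < m → ⟦ m ≤ᵇ n ⟧ * x ≈ 0#
  ⟦≤ᵇ⟧*-no x n<m rewrite ≤ᵇ-no n<m = zeroˡ x

  ⟦≤ᵇ⟧*-split : ∀ m n x → ⟦ m ≤ᵇ n ⟧ * x + ⟦ suc n ≤ᵇ m ⟧ * x ≈ x
  ⟦≤ᵇ⟧*-split m n x with ℕₚ.≤-<-connex m n
  ... | inj₁ m≤n = trans (+-cong (⟦≤ᵇ⟧*-yes x m≤n) (⟦≤ᵇ⟧*-no x (s≤s m≤n))) (+-identityʳ x)
  ... | inj₂ n<m = trans (+-cong (⟦≤ᵇ⟧*-no x n<m) (⟦≤ᵇ⟧*-yes x n<m)) (+-identityˡ x)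

  sumFrom : ℕ → ℕ → (ℕ → Carrier) → Carrier
  sumFrom lo N f = ∑ N (λ x → ⟦ lo ≤ᵇ x ⟧ * f x)

  sumFrom-zero : ∀ N (f : ℕ → Carrier) → sumFrom 0 N f ≈ ∑ N f
  sumFrom-zero N f = ∑-cong N (λ x _ → *-identityˡ (f x))

  sumFrom-empty : ∀ {lo N} (f : ℕ → Carrier) → N ≤ lo → sumFrom lo N f ≈ 0#
  sumFrom-empty {N = N} f N≤lo = ∑-zero N (λ x x<N → ⟦≤ᵇ⟧*-no (f x) (ℕₚ.<-≤-trans x<N N≤lo))

  sumFrom-step : ∀ {lo N} (f : ℕ → Carrier) → lo < N → sumFrom lo N f ≈ f lo + sumFrom (suc lo) N f
  sumFrom-step {lo} {suc N} f lo<1+N with ℕₚ.m≤n⇒m<n∨m≡n (ℕₚ.≤-pred lo<1+N)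
  ... | inj₂ ≡.refl = begin
    sumFrom lo (suc lo) f                  ≈⟨ ∑-last lo _ ⟩
    sumFrom lo lo f + ⟦ lo ≤ᵇ lo ⟧ * f lo
      ≈⟨ +-cong (sumFrom-empty f ℕₚ.≤-refl) (⟦≤ᵇ⟧*-yes (f lo) (ℕₚ.≤-refl {lo})) ⟩
    0# + f lo                              ≈⟨ +-comm 0# (f lo) ⟩
    f lo + 0#                              ≈⟨ +-congˡ (sym (sumFrom-empty {suc lo} {suc lo} f ℕₚ.≤-refl)) ⟩
    f lo + sumFrom (suc lo) (suc lo) f     ∎
  ... | inj₁ lo<N = begin
    sumFrom lo (suc N) f                                   ≈⟨ ∑-last N _ ⟩
    sumFrom lo N f + ⟦ lo ≤ᵇ N ⟧ * f N
      ≈⟨ +-cong (sumFrom-step f lo<N) (⟦≤ᵇ⟧*-yes (f N) (ℕₚ.<⇒≤ lo<N)) ⟩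
    (f lo + sumFrom (suc lo) N f) + f N                    ≈⟨ +-assoc _ _ _ ⟩
    f lo + (sumFrom (suc lo) N f + f N)                    ≈⟨ +-congˡ (+-congˡ (sym (⟦≤ᵇ⟧*-yes (f N) lo<N))) ⟩
    f lo + (sumFrom (suc lo) N f + ⟦ suc lo ≤ᵇ N ⟧ * f N)  ≈⟨ +-congˡ (sym (∑-last N _)) ⟩
    f lo + sumFrom (suc lo) (suc N) f                      ∎

  ∑-split-at : ∀ N b (f : ℕ → Carrier) → ∑ N (λ x → ⟦ x ≤ᵇ b ⟧ * f x) + sumFrom (suc b) N f ≈ ∑ N f
  ∑-split-at N b f = trans (sym (∑-+ N _ _)) (∑-cong N (λ x _ → ⟦≤ᵇ⟧*-split x b (f x)))

  pow≡^ : ∀ x n → pow x n ≡ x Exp.^ n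
  pow≡^ x zero = ≡.refl
  pow≡^ x (suc n) = ≡.cong (x *_) (pow≡^ x n)

  pow-+ : ∀ x m n → pow x (m ℕ.+ n) ≈ pow x m * pow x n
  pow-+ x m n rewrite pow≡^ x (m ℕ.+ n) | pow≡^ x m | pow≡^ x n = Exp.^-homo-* x m n

  pow-cong : ∀ x {m n} → m ≡ n → pow x m ≈ pow x n
  pow-cong x ≡.refl = refl

  sign : ℕ → Carrier
  sign s = signed s 1#

  signed≈sign* : ∀ s x → signed s x ≈ sign s * x
  signed≈sign* zero x = sym (*-identityˡ x)
  signed≈sign* (suc s) x = trans (-‿cong (signed≈sign* s x)) (-‿distribˡ-* (sign s) x)

  sign-+ : ∀ m n → sign (m ℕ.+ n) ≈ sign m * sign n
  sign-+ m n = trans (reflexive (signed-+ m)) (signed≈sign* m (sign n))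
    where
    signed-+ : ∀ m → sign (m ℕ.+ n) ≡ signed m (sign n)
    signed-+ zero = ≡.refl
    signed-+ (suc m) = ≡.cong -_ (signed-+ m)

  sign-square : ∀ s → sign s * sign s ≈ 1#
  sign-square zero = *-identityˡ 1#
  sign-square (suc s) = begin
    - sign s * - sign s    ≈⟨ -‿distribˡ-* (sign s) (- sign s) ⟨
    - (sign s * - sign s)  ≈⟨ -‿cong (-‿distribʳ-* (sign s) (sign s)) ⟨
    - - (sign s * sign s)  ≈⟨ -‿involutive _ ⟩
    sign s * sign s        ≈⟨ sign-square s ⟩
    1#                     ∎

  sign-split : ∀ {p t} → t ≤ p → sign p * sign (p ∸ t) ≈ sign t
  sign-split {p} {t} t≤p = begin
    sign p * sign (p ∸ t)                   ≈⟨ *-congʳ (reflexive (≡.cong sign (≡.sym (ℕₚ.m∸n+n≡m t≤p)))) ⟩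
    sign (p ∸ t ℕ.+ t) * sign (p ∸ t)       ≈⟨ *-congʳ (sign-+ (p ∸ t) t) ⟩
    (sign (p ∸ t) * sign t) * sign (p ∸ t)  ≈⟨ *-congʳ (*-comm _ _) ⟩
    (sign t * sign (p ∸ t)) * sign (p ∸ t)  ≈⟨ *-assoc _ _ _ ⟩
    sign t * (sign (p ∸ t) * sign (p ∸ t))  ≈⟨ *-congˡ (sign-square (p ∸ t)) ⟩
    sign t * 1#                             ≈⟨ *-identityʳ _ ⟩
    sign t                                  ∎


  sumList-++ : ∀ xs ys → sumList (xs ++ ys) ≈ sumList xs + sumList ys
  sumList-++ [] ys = sym (+-identityˡ _)
  sumList-++ (x ∷ xs) ys = trans (+-congˡ (sumList-++ xs ys)) (sym (+-assoc _ _ _))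

  sumList-concatMap : ∀ {A B : Set} (f : B → Carrier) (g : A → List B) xs →
                      sumList (map f (concatMap g xs)) ≈ sumList (map (λ x → sumList (map f (g x))) xs)
  sumList-concatMap f g [] = refl
  sumList-concatMap f g (x ∷ xs) =
    trans (reflexive (≡.cong sumList (Listₚ.map-++ f (g x) (concatMap g xs))))
          (trans (sumList-++ (map f (g x)) _) (+-congˡ (sumList-concatMap f g xs)))

  sumList-onlyIf : ∀ {A : Set} (f : A → Carrier) b xs → sumList (map f (onlyIf b xs)) ≈ ⟦ b ⟧ * sumList (map f xs)
  sumList-onlyIf f true xs = sym (*-identityˡ _)
  sumList-onlyIf f false xs = sym (zeroˡ _)

  sumList-*ˡ : ∀ {A : Set} a (f : A → Carrier) xs → sumList (map (λ x → a * f x) xs) ≈ a * sumList (map f xs)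
  sumList-*ˡ a f [] = sym (zeroʳ a)
  sumList-*ˡ a f (x ∷ xs) = trans (+-congˡ (sumList-*ˡ a f xs)) (sym (distribˡ a _ _))

  sumList-cong : ∀ {A : Set} (f g : A → Carrier) xs → (∀ {x} → x ∈ xs → f x ≈ g x) →
                 sumList (map f xs) ≈ sumList (map g xs)
  sumList-cong f g [] _ = refl
  sumList-cong f g (x ∷ xs) f≈g = +-cong (f≈g (here ≡.refl)) (sumList-cong f g xs (λ x∈ → f≈g (there x∈)))

  sumList-upTo : ∀ N (f : ℕ → Carrier) → sumList (map f (upTo N)) ≈ ∑ N f
  sumList-upTo N f = reflexive (≡.trans (≡.cong sumList (Listₚ.map-upTo f N)) (≡.sym (∑≡sumList N f)))

  sumList-↭ : ∀ {xs ys} → xs ↭ ys → sumList xs ≈ sumList ys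
  sumList-↭ {xs} {ys} xs↭ys = begin
    sumList xs           ≡⟨ as-foldr xs ⟩
    foldr _+_ 0# xs
      ≈⟨ SetoidPermutationₚ.foldr-commMonoid setoid +-isCommutativeMonoid (↭⇒↭ₛ′ isEquivalence xs↭ys) ⟩
    foldr _+_ 0# ys      ≡⟨ as-foldr ys ⟨
    sumList ys           ∎
    where
    as-foldr : ∀ xs → sumList xs ≡ foldr _+_ 0# xs
    as-foldr [] = ≡.refl
    as-foldr (x ∷ xs) = ≡.cong (x +_) (as-foldr xs)

module QChains {c ℓ : Level} (R : CommutativeRing c ℓ) (q : CommutativeRing.Carrier R) where
  open CommutativeRing R hiding (zero)
  open WithRing R using (pow; qbin; G)
  open Summation R
  open import Algebra.Properties.CommutativeSemigroup *-commutativeSemigroup using (x∙yz≈y∙xz)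
  open import Relation.Binary.Reasoning.Setoid setoid
  open import Data.Nat.Tactic.RingSolver using (solve-∀)

  qbin-vanishes : ∀ m r → m < r → qbin q m r ≈ 0#
  qbin-vanishes zero (suc r) _ = refl
  qbin-vanishes (suc m) (suc r) (s≤s m<r) = begin
    qbin q m r + pow q (suc r) * qbin q m (suc r)  ≈⟨ +-congˡ (*-congˡ (qbin-vanishes m (suc r) (ℕₚ.m<n⇒m<1+n m<r))) ⟩
    qbin q m r + pow q (suc r) * 0#                ≈⟨ +-cong (qbin-vanishes m r m<r) (zeroʳ _) ⟩
    0# + 0#                                        ≈⟨ +-identityʳ 0# ⟩
    0#                                             ∎

  G-entry : ∀ j d → G q (j ℕ.+ d) j ≡ qbin q (j ℕ.+ d) (2 ℕ.* d) * pow q ((d ∸ 1) ℕ.* d)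
  G-entry j d rewrite ≤ᵇ-yes (ℕₚ.m≤m+n j d) | ℕₚ.m+n∸m≡n j d = ≡.refl

  G-diag : ∀ i → G q i i ≈ 1#
  G-diag i = trans (reflexive (≡.trans (≡.cong (λ x → G q x i) (≡.sym (ℕₚ.+-identityʳ i))) (G-entry i 0)))
                   (*-identityˡ 1#)

  pow-scale : ∀ a e x → pow q a * (pow q e * x) ≈ pow q (a ℕ.+ e) * x
  pow-scale a e x = trans (sym (*-assoc _ _ _)) (*-congʳ (sym (pow-+ q a e)))

  -- The q-Pascal rule, after multiplying through by a power of q.
  q-pascal-step : ∀ lo a b e m r → lo ℕ.+ a ≡ e → b ≡ e ℕ.+ suc r →
                  pow q lo * (pow q a * qbin q m r) + pow q b * qbin q m (suc r) ≈ pow q e * qbin q (suc m) (suc r)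
  q-pascal-step lo a b e m r ≡.refl ≡.refl = begin
    pow q lo * (pow q a * qbin q m r) + pow q (e ℕ.+ suc r) * qbin q m (suc r)
      ≈⟨ +-cong (pow-scale lo a _) (sym (pow-scale e (suc r) _)) ⟩
    pow q e * qbin q m r + pow q e * (pow q (suc r) * qbin q m (suc r))  ≈⟨ distribˡ _ _ _ ⟨
    pow q e * qbin q (suc m) (suc r)                                      ∎

  pairWeight : ℕ → ℕ → Carrier
  pairWeight a b = ⟦ a ≤ᵇ b ⟧ * pow q (a ℕ.+ b)

  pairSum : ℕ → ℕ → (ℕ → Carrier) → Carrier
  pairSum N a g = ∑ N (λ b → pairWeight a b * g b)

  -- chains d N a = Σ q^(a₀ + b₀ + ⋯ + a_d + b_d) over a = a₀ ≤ b₀ < a₁ ≤ b₁ < ⋯ < a_d ≤ b_d < N,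
  -- and chainsAbove d N b is the same sum over the last d pairs, all of which lie above b.
  chains chainsAbove : ℕ → ℕ → ℕ → Carrier
  chains d N a = pairSum N a (chainsAbove d N)
  chainsAbove zero N b = 1#
  chainsAbove (suc d) N b = sumFrom (suc b) N (chains d N)

  pairSum-factor : ∀ N a g → pairSum N a g ≈ pow q a * sumFrom a N (λ b → pow q b * g b)
  pairSum-factor N a g = trans (∑-cong N (λ b _ → rearrange b)) (∑-*ˡ N (pow q a) _)
    where
    rearrange : ∀ b → pairWeight a b * g b ≈ pow q a * (⟦ a ≤ᵇ b ⟧ * (pow q b * g b))
    rearrange b = begin
      (⟦ a ≤ᵇ b ⟧ * pow q (a ℕ.+ b)) * g b           ≈⟨ *-assoc _ _ _ ⟩
      ⟦ a ≤ᵇ b ⟧ * (pow q (a ℕ.+ b) * g b)           ≈⟨ *-congˡ (*-congʳ (pow-+ q a b)) ⟩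
      ⟦ a ≤ᵇ b ⟧ * ((pow q a * pow q b) * g b)       ≈⟨ *-congˡ (*-assoc _ _ _) ⟩
      ⟦ a ≤ᵇ b ⟧ * (pow q a * (pow q b * g b))       ≈⟨ x∙yz≈y∙xz _ _ _ ⟩
      pow q a * (⟦ a ≤ᵇ b ⟧ * (pow q b * g b))       ∎

  chains-vanish : ∀ d {N a} → N ≤ a → chains d N a ≈ 0#
  chains-vanish d {N} {a} N≤a = ∑-zero N (λ b b<N →
    trans (*-congʳ (⟦≤ᵇ⟧*-no (pow q (a ℕ.+ b)) (ℕₚ.<-≤-trans b<N N≤a))) (zeroˡ _))

  module ChainCount (N : ℕ) where

    private
      below : ∀ {lo M} → lo ℕ.+ suc M ≡ N → lo < N
      below {lo} ≡.refl = ℕₚ.m<m+n lo (s≤s z≤n)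

      shift : ∀ {lo M} → lo ℕ.+ suc M ≡ N → suc lo ℕ.+ M ≡ N
      shift {lo} {M} eq = ≡.trans (≡.sym (ℕₚ.+-suc lo M)) eq

      empty : ∀ {lo} → lo ℕ.+ 0 ≡ N → N ≤ lo
      empty {lo} eq = ℕₚ.≤-reflexive (≡.trans (≡.sym eq) (ℕₚ.+-identityʳ lo))

    evenExp oddExp : ℕ → ℕ → ℕ
    evenExp d lo = suc (suc (2 ℕ.* d)) ℕ.* lo ℕ.+ d ℕ.* suc d
    oddExp d lo = suc (2 ℕ.* d) ℕ.* lo ℕ.+ d ℕ.* suc d

    chainsFrom-closed : ∀ d M lo → lo ℕ.+ M ≡ N →
                        sumFrom lo N (chains d N) ≈ pow q (evenExp d lo) * qbin q (M ℕ.+ suc d) (suc (suc (2 ℕ.* d)))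
    tailsFrom-closed : ∀ d M lo → lo ℕ.+ M ≡ N →
                       sumFrom lo N (λ b → pow q b * chainsAbove d N b) ≈ pow q (oddExp d lo) * qbin q (M ℕ.+ d) (suc (2 ℕ.* d))

    chainsFrom-closed d zero lo eq = begin
      sumFrom lo N (chains d N)  ≈⟨ sumFrom-empty _ (empty eq) ⟩
      0#                         ≈⟨ zeroʳ _ ⟨
      pow q (evenExp d lo) * 0#  ≈⟨ *-congˡ (qbin-vanishes (suc d) _ (s≤s (s≤s (ℕₚ.m≤m+n d _)))) ⟨
      pow q (evenExp d lo) * qbin q (suc d) (suc (suc (2 ℕ.* d))) ∎
    chainsFrom-closed d (suc M) lo eq = begin
      sumFrom lo N (chains d N)
        ≈⟨ sumFrom-step _ (below eq) ⟩
      chains d N lo + sumFrom (suc lo) N (chains d N)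
        ≈⟨ +-cong (trans (pairSum-factor N lo _) (*-congˡ (tailsFrom-closed d (suc M) lo eq)))
                  (chainsFrom-closed d M (suc lo) (shift eq)) ⟩
      pow q lo * (pow q (oddExp d lo) * qbin q (suc M ℕ.+ d) r) + pow q (evenExp d (suc lo)) * qbin q m (suc r)
        ≈⟨ +-congʳ (*-congˡ (*-congˡ (reflexive (≡.cong (λ m → qbin q m r) (≡.sym (ℕₚ.+-suc M d)))))) ⟩
      pow q lo * (pow q (oddExp d lo) * qbin q m r) + pow q (evenExp d (suc lo)) * qbin q m (suc r)
        ≈⟨ q-pascal-step lo _ _ _ m r (exp₁ d lo) (exp₂ d lo) ⟩
      pow q (evenExp d lo) * qbin q (suc m) (suc r) ∎
      where
      m r : ℕ
      m = M ℕ.+ suc d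
      r = suc (2 ℕ.* d)
      exp₁ : ∀ d lo → lo ℕ.+ (suc (2 ℕ.* d) ℕ.* lo ℕ.+ d ℕ.* suc d)
             ≡ suc (suc (2 ℕ.* d)) ℕ.* lo ℕ.+ d ℕ.* suc d
      exp₁ = solve-∀
      exp₂ : ∀ d lo → suc (suc (2 ℕ.* d)) ℕ.* suc lo ℕ.+ d ℕ.* suc d ≡
             (suc (suc (2 ℕ.* d)) ℕ.* lo ℕ.+ d ℕ.* suc d) ℕ.+ suc (suc (2 ℕ.* d))
      exp₂ = solve-∀

    tailsFrom-closed d zero lo eq = begin
      sumFrom lo N (λ b → pow q b * chainsAbove d N b)  ≈⟨ sumFrom-empty _ (empty eq) ⟩
      0#                                                ≈⟨ zeroʳ _ ⟨
      pow q (oddExp d lo) * 0#                          ≈⟨ *-congˡ (qbin-vanishes d _ (s≤s (ℕₚ.m≤m+n d _))) ⟨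
      pow q (oddExp d lo) * qbin q d (suc (2 ℕ.* d))    ∎
    tailsFrom-closed zero (suc M) lo eq = begin
      sumFrom lo N (λ b → pow q b * 1#)
        ≈⟨ sumFrom-step _ (below eq) ⟩
      pow q lo * 1# + sumFrom (suc lo) N (λ b → pow q b * 1#)
        ≈⟨ +-cong (*-congˡ (sym (*-identityˡ 1#))) (tailsFrom-closed zero M (suc lo) (shift eq)) ⟩
      pow q lo * (pow q 0 * qbin q (M ℕ.+ 0) 0) + pow q (oddExp 0 (suc lo)) * qbin q (M ℕ.+ 0) 1
        ≈⟨ q-pascal-step lo 0 _ _ (M ℕ.+ 0) 0 (exp₁ lo) (exp₂ lo) ⟩
      pow q (oddExp 0 lo) * qbin q (suc M ℕ.+ 0) 1 ∎
      where
      exp₁ : ∀ lo → lo ℕ.+ 0 ≡ 1 ℕ.* lo ℕ.+ 0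
      exp₁ = solve-∀
      exp₂ : ∀ lo → 1 ℕ.* suc lo ℕ.+ 0 ≡ (1 ℕ.* lo ℕ.+ 0) ℕ.+ 1
      exp₂ = solve-∀
    tailsFrom-closed (suc e) (suc M) lo eq = begin
      sumFrom lo N (λ b → pow q b * chainsAbove (suc e) N b)
        ≈⟨ sumFrom-step _ (below eq) ⟩
      pow q lo * sumFrom (suc lo) N (chains e N) + sumFrom (suc lo) N (λ b → pow q b * chainsAbove (suc e) N b)
        ≈⟨ +-cong (*-congˡ (chainsFrom-closed e M (suc lo) (shift eq))) (tailsFrom-closed (suc e) M (suc lo) (shift eq)) ⟩
      pow q lo * (pow q (evenExp e (suc lo)) * qbin q m (suc (suc (2 ℕ.* e)))) + pow q (oddExp (suc e) (suc lo)) * qbin q m (suc r)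
        ≈⟨ +-congʳ (*-congˡ (*-congˡ (reflexive (≡.cong (qbin q m) (≡.sym (ℕₚ.*-suc 2 e)))))) ⟩
      pow q lo * (pow q (evenExp e (suc lo)) * qbin q m r) + pow q (oddExp (suc e) (suc lo)) * qbin q m (suc r)
        ≈⟨ q-pascal-step lo _ _ _ m r (exp₁ e lo) (exp₂ e lo) ⟩
      pow q (oddExp (suc e) lo) * qbin q (suc m) (suc r) ∎
      where
      m r : ℕ
      m = M ℕ.+ suc e
      r = 2 ℕ.* suc e
      exp₁ : ∀ e lo → lo ℕ.+ (suc (suc (2 ℕ.* e)) ℕ.* suc lo ℕ.+ e ℕ.* suc e) ≡
             suc (2 ℕ.* suc e) ℕ.* lo ℕ.+ suc e ℕ.* suc (suc e)
      exp₁ = solve-∀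
      exp₂ : ∀ e lo → suc (2 ℕ.* suc e) ℕ.* suc lo ℕ.+ suc e ℕ.* suc (suc e) ≡
             (suc (2 ℕ.* suc e) ℕ.* lo ℕ.+ suc e ℕ.* suc (suc e)) ℕ.+ suc (2 ℕ.* suc e)
      exp₂ = solve-∀

  chains-total : ∀ N s → ∑ N (chains s N) ≈ G q (N ℕ.+ suc s) N
  chains-total N s = begin
    ∑ N (chains s N)           ≈⟨ sumFrom-zero N _ ⟨
    sumFrom 0 N (chains s N)   ≈⟨ ChainCount.chainsFrom-closed N s N 0 ≡.refl ⟩
    pow q (suc (suc (2 ℕ.* s)) ℕ.* 0 ℕ.+ s ℕ.* suc s) * qbin q (N ℕ.+ suc s) (suc (suc (2 ℕ.* s)))
      ≈⟨ *-comm _ _ ⟩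
    qbin q (N ℕ.+ suc s) (suc (suc (2 ℕ.* s))) * pow q (suc (suc (2 ℕ.* s)) ℕ.* 0 ℕ.+ s ℕ.* suc s)
      ≈⟨ *-cong (reflexive (≡.cong (qbin q (N ℕ.+ suc s)) (≡.sym (ℕₚ.*-suc 2 s))))
                (pow-cong q (≡.cong (ℕ._+ s ℕ.* suc s) (ℕₚ.*-zeroʳ (suc (suc (2 ℕ.* s)))))) ⟩
    qbin q (N ℕ.+ suc s) (2 ℕ.* suc s) * pow q (s ℕ.* suc s)  ≡⟨ G-entry N (suc s) ⟨
    G q (N ℕ.+ suc s) N ∎

module AdmissibleSequences {c ℓ : Level} (R : CommutativeRing c ℓ) (q : CommutativeRing.Carrier R) (l : ℕ) where
  open CommutativeRing R hiding (zero)
  open WithRing R using (pow; G)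
  open Summation R
  open QChains R q
  open import Algebra.Properties.Ring ring using (-‿distribˡ-*)
  open import Algebra.Properties.Group +-group using (x≈z//y)
  open import Relation.Binary.Reasoning.Setoid setoid

  -- Weighted counts of the sequences (a_l , b_l) , … , (a_{l+p-1} , b_{l+p-1}) with
  -- a_i ≤ b_i < i and a_i ≤ b_{i+1}: capped p cap requires a_{l+p-1} ≤ cap, topped p a counts
  -- the sequences of length p + 1 with a_{l+p} = a, and total p counts all of them.
  capped topped : ℕ → ℕ → Carrier
  capped zero cap = 1#
  capped (suc p) cap = ∑ (l ℕ.+ p) (λ a → ⟦ a ≤ᵇ cap ⟧ * topped p a)
  topped p a = pairSum (l ℕ.+ p) a (capped p)

  total : ℕ → Carrier
  total zero = 1#
  total (suc p) = ∑ (l ℕ.+ p) (topped p)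

  capped-total : ∀ p → capped p (l ℕ.+ p) ≈ total p
  capped-total zero = refl
  capped-total (suc p) = ∑-cong (l ℕ.+ p) (λ a a<l+p →
    ⟦≤ᵇ⟧*-yes (topped p a) (ℕₚ.≤-trans (ℕₚ.<⇒≤ a<l+p) (ℕₚ.+-monoʳ-≤ l (ℕₚ.n≤1+n p))))

  coefficient : ℕ → ℕ → Carrier
  coefficient p t = sign (p ∸ t) * total t

  -- Inclusion–exclusion on the constraints a_i ≤ b_{i+1}: the last block of violated
  -- constraints, starting at index l + t, is a chain counted by `chains`.
  topped-alternating : ∀ p a → topped p a ≈ ∑ (suc p) (λ t → coefficient p t * chains (p ∸ t) (l ℕ.+ t) a)
  topped-alternating zero a = begin
    chains 0 (l ℕ.+ 0) a                    ≈⟨ trans (*-congʳ (*-identityˡ 1#)) (*-identityˡ _) ⟨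
    coefficient 0 0 * chains 0 (l ℕ.+ 0) a  ≈⟨ ∑-one _ ⟨
    ∑ 1 (λ t → coefficient 0 t * chains (0 ∸ t) (l ℕ.+ t) a) ∎
  topped-alternating (suc p) a = begin
    ∑ N′ (λ β → pairWeight a β * capped (suc p) β)
      ≈⟨ ∑-cong N′ (λ β _ → *-congˡ (capped-expanded β)) ⟩
    ∑ N′ (λ β → pairWeight a β * (total (suc p) - ∑ (suc p) (λ t → coefficient p t * above t β)))
      ≈⟨ ∑-affine N′ (suc p) (pairWeight a) (coefficient p) above (total (suc p)) ⟩
    ∑ N′ (pairWeight a) * total (suc p) - ∑ (suc p) (λ t → coefficient p t * pairSum N′ a (above t))
      ≈⟨ +-cong (*-congʳ (∑-cong N′ (λ β _ → sym (*-identityʳ _))))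
                (-‿cong (∑-cong (suc p) (λ t t<1+p → *-congˡ (longer-chain t (ℕₚ.≤-pred t<1+p))))) ⟩
    chains 0 N′ a * total (suc p) - ∑ (suc p) (λ t → coefficient p t * chains (suc (p ∸ t)) (l ℕ.+ t) a)
      ≈⟨ +-comm _ _ ⟩
    - ∑ (suc p) (λ t → coefficient p t * chains (suc (p ∸ t)) (l ℕ.+ t) a) + chains 0 N′ a * total (suc p)
      ≈⟨ +-cong (trans (sym (∑-neg (suc p) _)) (∑-cong (suc p) (λ t t<1+p → sym (sign-flip t (ℕₚ.≤-pred t<1+p)))))
                (sym last-term) ⟩
    ∑ (suc p) (λ t → coefficient (suc p) t * chains (suc p ∸ t) (l ℕ.+ t) a)
      + coefficient (suc p) (suc p) * chains (suc p ∸ suc p) (l ℕ.+ suc p) a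
      ≈⟨ ∑-last (suc p) _ ⟨
    ∑ (suc (suc p)) (λ t → coefficient (suc p) t * chains (suc p ∸ t) (l ℕ.+ t) a) ∎
    where
    N′ : ℕ
    N′ = l ℕ.+ suc p
    above : ℕ → ℕ → Carrier
    above t β = sumFrom (suc β) (l ℕ.+ t) (chains (p ∸ t) (l ℕ.+ t))

    capped-expanded : ∀ β → capped (suc p) β ≈ total (suc p) - ∑ (suc p) (λ t → coefficient p t * above t β)
    capped-expanded β = begin
      capped (suc p) β
        ≈⟨ x≈z//y _ _ _ (∑-split-at (l ℕ.+ p) β (topped p)) ⟩
      total (suc p) - sumFrom (suc β) (l ℕ.+ p) (topped p)
        ≈⟨ +-congˡ (-‿cong (∑-cong (l ℕ.+ p) (λ a′ _ → *-congˡ (topped-alternating p a′)))) ⟩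
      total (suc p) - ∑ (l ℕ.+ p)
            (λ a′ → ⟦ suc β ≤ᵇ a′ ⟧ * ∑ (suc p) (λ t → coefficient p t * chains (p ∸ t) (l ℕ.+ t) a′))
        ≈⟨ +-congˡ (-‿cong (∑-interchange (l ℕ.+ p) (suc p) _ (coefficient p)
              (λ t → chains (p ∸ t) (l ℕ.+ t)))) ⟩
      total (suc p) - ∑ (suc p) (λ t → coefficient p t * sumFrom (suc β) (l ℕ.+ p) (chains (p ∸ t) (l ℕ.+ t)))
        ≈⟨ +-congˡ (-‿cong (∑-cong (suc p) (λ t t<1+p → *-congˡ
             (∑-*-truncate _ _ (ℕₚ.+-monoʳ-≤ l (ℕₚ.≤-pred t<1+p)) (λ a′ → chains-vanish (p ∸ t)))))) ⟩
      total (suc p) - ∑ (suc p) (λ t → coefficient p t * above t β) ∎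

    longer-chain : ∀ t → t ≤ p → pairSum N′ a (above t) ≈ chains (suc (p ∸ t)) (l ℕ.+ t) a
    longer-chain t t≤p = ∑-*-truncate (pairWeight a) (above t) (ℕₚ.+-monoʳ-≤ l (ℕₚ.m≤n⇒m≤1+n t≤p))
      (λ β l+t≤β → sumFrom-empty _ (ℕₚ.≤-trans l+t≤β (ℕₚ.n≤1+n β)))

    sign-flip : ∀ t → t ≤ p → coefficient (suc p) t * chains (suc p ∸ t) (l ℕ.+ t) a ≈
                - (coefficient p t * chains (suc (p ∸ t)) (l ℕ.+ t) a)
    sign-flip t t≤p rewrite ℕₚ.+-∸-assoc 1 t≤p =
      trans (*-congʳ (sym (-‿distribˡ-* _ _))) (sym (-‿distribˡ-* _ _))

    last-term : coefficient (suc p) (suc p) * chains (suc p ∸ suc p) N′ a ≈ chains 0 N′ a * total (suc p)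
    last-term rewrite ℕₚ.n∸n≡0 p = trans (*-congʳ (*-identityˡ _)) (*-comm _ _)

  total-recursion : ∀ p → total (suc p) ≈ ∑ (suc p) (λ t → coefficient p t * G q (l ℕ.+ suc p) (l ℕ.+ t))
  total-recursion p = begin
    ∑ (l ℕ.+ p) (topped p)
      ≈⟨ ∑-cong (l ℕ.+ p) (λ a _ → topped-alternating p a) ⟩
    ∑ (l ℕ.+ p) (λ a → ∑ (suc p) (λ t → coefficient p t * chains (p ∸ t) (l ℕ.+ t) a))
      ≈⟨ ∑-swap (l ℕ.+ p) (suc p) _ ⟩
    ∑ (suc p) (λ t → ∑ (l ℕ.+ p) (λ a → coefficient p t * chains (p ∸ t) (l ℕ.+ t) a))
      ≈⟨ ∑-cong (suc p) (λ t t<1+p → trans (∑-*ˡ (l ℕ.+ p) _ _) (*-congˡ (count t (ℕₚ.≤-pred t<1+p)))) ⟩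
    ∑ (suc p) (λ t → coefficient p t * G q (l ℕ.+ suc p) (l ℕ.+ t)) ∎
    where
    count : ∀ t → t ≤ p → ∑ (l ℕ.+ p) (chains (p ∸ t) (l ℕ.+ t)) ≈ G q (l ℕ.+ suc p) (l ℕ.+ t)
    count t t≤p = begin
      ∑ (l ℕ.+ p) (chains (p ∸ t) (l ℕ.+ t))
        ≈⟨ ∑-truncate (ℕₚ.+-monoʳ-≤ l t≤p) (λ a → chains-vanish (p ∸ t)) ⟩
      ∑ (l ℕ.+ t) (chains (p ∸ t) (l ℕ.+ t))  ≈⟨ chains-total (l ℕ.+ t) (p ∸ t) ⟩
      G q (l ℕ.+ t ℕ.+ suc (p ∸ t)) (l ℕ.+ t) ≡⟨ ≡.cong (λ i → G q i (l ℕ.+ t)) index ⟩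
      G q (l ℕ.+ suc p) (l ℕ.+ t)             ∎
      where
      index : l ℕ.+ t ℕ.+ suc (p ∸ t) ≡ l ℕ.+ suc p
      index = ≡.trans (ℕₚ.+-assoc l t _)
          (≡.cong (l ℕ.+_) (≡.trans (ℕₚ.+-suc t (p ∸ t)) (≡.cong suc (ℕₚ.m+[n∸m]≡n t≤p))))

module UnitriangularSystems {c ℓ : Level} (R : CommutativeRing c ℓ) where
  open CommutativeRing R hiding (zero)
  open WithRing R using (sumTo)
  open Summation R using (∑; ∑-empty; ∑-last)
  open import Algebra.Properties.Group +-group using (∙-cancelˡ)
  open import Relation.Binary.Reasoning.Setoid setoid

  sumTo-cong : ∀ i {f g : ℕ → Carrier} → (∀ m → 1 ≤ m → m ≤ i → f m ≈ g m) → sumTo f i ≈ sumTo g i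
  sumTo-cong zero f≈g = refl
  sumTo-cong (suc i) f≈g = +-cong (sumTo-cong i (λ m 1≤m m≤i → f≈g m 1≤m (ℕₚ.m≤n⇒m≤1+n m≤i)))
                                  (f≈g (suc i) (s≤s z≤n) ℕₚ.≤-refl)

  sumTo-vanishes : ∀ i {f : ℕ → Carrier} → (∀ m → 1 ≤ m → m ≤ i → f m ≈ 0#) → sumTo f i ≈ 0#
  sumTo-vanishes zero f≈0 = refl
  sumTo-vanishes (suc i) f≈0 = trans (+-cong (sumTo-vanishes i (λ m 1≤m m≤i → f≈0 m 1≤m (ℕₚ.m≤n⇒m≤1+n m≤i)))
                                             (f≈0 (suc i) (s≤s z≤n) ℕₚ.≤-refl))
                                     (+-identityʳ 0#)

  sumTo-split : ∀ (f : ℕ → Carrier) a n → sumTo f (a ℕ.+ n) ≈ sumTo f a + ∑ n (λ t → f (suc a ℕ.+ t))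
  sumTo-split f a zero = begin
    sumTo f (a ℕ.+ 0)                        ≡⟨ ≡.cong (sumTo f) (ℕₚ.+-identityʳ a) ⟩
    sumTo f a                                ≈⟨ +-identityʳ _ ⟨
    sumTo f a + 0#                           ≈⟨ +-congˡ (∑-empty _) ⟨
    sumTo f a + ∑ 0 (λ t → f (suc a ℕ.+ t))  ∎
  sumTo-split f a (suc n) = begin
    sumTo f (a ℕ.+ suc n)                                              ≡⟨ ≡.cong (sumTo f) (ℕₚ.+-suc a n) ⟩
    sumTo f (a ℕ.+ n) + f (suc a ℕ.+ n)                                ≈⟨ +-congʳ (sumTo-split f a n) ⟩
    (sumTo f a + ∑ n (λ t → f (suc a ℕ.+ t))) + f (suc a ℕ.+ n)        ≈⟨ +-assoc _ _ _ ⟩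
    sumTo f a + (∑ n (λ t → f (suc a ℕ.+ t)) + f (suc a ℕ.+ n))        ≈⟨ +-congˡ (∑-last n _) ⟨
    sumTo f a + ∑ (suc n) (λ t → f (suc a ℕ.+ t))                      ∎

  unitriangular-unique : (M : ℕ → ℕ → Carrier) → (∀ i → M i i ≈ 1#) → (x y : ℕ → Carrier) →
                         (∀ i → 1 ≤ i → sumTo (λ m → M i m * x m) i ≈ sumTo (λ m → M i m * y m) i) →
                         ∀ i → 1 ≤ i → x i ≈ y i
  unitriangular-unique M diag x y same i 1≤i = agree i i 1≤i ℕₚ.≤-refl
    where
    agree : ∀ i m → 1 ≤ m → m ≤ i → x m ≈ y m
    agree zero (suc m) _ ()
    agree (suc i) m 1≤m m≤1+i with ℕₚ.m≤n⇒m<n∨m≡n m≤1+i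
    ... | inj₁ m<1+i = agree i m 1≤m (ℕₚ.≤-pred m<1+i)
    ... | inj₂ ≡.refl = begin
      x (suc i)              ≈⟨ unit x ⟨
      M (suc i) (suc i) * x (suc i)  ≈⟨ ∙-cancelˡ (sumTo (λ m → M (suc i) m * x m) i) _ _ step ⟩
      M (suc i) (suc i) * y (suc i)  ≈⟨ unit y ⟩
      y (suc i)              ∎
      where
      unit : ∀ z → M (suc i) (suc i) * z (suc i) ≈ z (suc i)
      unit z = trans (*-congʳ (diag (suc i))) (*-identityˡ _)
      step : sumTo (λ m → M (suc i) m * x m) i + M (suc i) (suc i) * x (suc i) ≈
             sumTo (λ m → M (suc i) m * x m) i + M (suc i) (suc i) * y (suc i)
      step = trans (same (suc i) (s≤s z≤n))
                   (+-congʳ (sumTo-cong i (λ m 1≤m m≤i → *-congˡ (sym (agree i m 1≤m m≤i)))))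

module InverseColumn {c ℓ : Level} (R : CommutativeRing c ℓ) (q : CommutativeRing.Carrier R) (l₀ : ℕ)
                     (H : ℕ → ℕ → CommutativeRing.Carrier R) (inv : WithRing.IsInverseG R q H) where
  open CommutativeRing R hiding (zero)
  open WithRing R using (G; sumTo; δ; signed)
  open Summation R
  open QChains R q using (G-diag)
  open UnitriangularSystems R
  open AdmissibleSequences R q (suc l₀)
  open import Algebra.Properties.Ring ring using (-‿distribˡ-*)
  open import Relation.Binary.Reasoning.Setoid setoid

  l : ℕ
  l = suc l₀

  δ-on : ∀ {i j} → i ≡ j → δ i j ≡ 1#
  δ-on i≡j rewrite ≡ᵇ-yes i≡j = ≡.refl

  δ-off : ∀ {i j} → i ≢ j → δ i j ≡ 0#
  δ-off i≢j rewrite ≡ᵇ-no i≢j = ≡.refl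

  column : ℕ → Carrier
  column m = ⟦ l ≤ᵇ m ⟧ * (sign (m ∸ l) * total (m ∸ l))

  column-below : ∀ {m} → m < l → column m ≈ 0#
  column-below m<l = ⟦≤ᵇ⟧*-no _ m<l

  column-at : ∀ t → column (l ℕ.+ t) ≈ sign t * total t
  column-at t = trans (⟦≤ᵇ⟧*-yes _ (ℕₚ.m≤m+n l t))
      (reflexive (≡.cong (λ s → sign s * total s) (ℕₚ.m+n∸m≡n l t)))

  column-term : ∀ {p t} → t ≤ p → G q (l ℕ.+ suc p) (l ℕ.+ t) * (sign t * total t) ≈
                sign p * (coefficient p t * G q (l ℕ.+ suc p) (l ℕ.+ t))
  column-term {p} {t} t≤p = begin
    g * (sign t * total t)                      ≈⟨ *-comm _ _ ⟩
    (sign t * total t) * g                      ≈⟨ *-congʳ (*-congʳ (sign-split t≤p)) ⟨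
    ((sign p * sign (p ∸ t)) * total t) * g     ≈⟨ *-congʳ (*-assoc _ _ _) ⟩
    (sign p * coefficient p t) * g              ≈⟨ *-assoc _ _ _ ⟩
    sign p * (coefficient p t * g)              ∎
    where
    g : Carrier
    g = G q (l ℕ.+ suc p) (l ℕ.+ t)

  column-solves-from-l : ∀ p → ∑ (suc p) (λ t → G q (l ℕ.+ p) (l ℕ.+ t) * (sign t * total t)) ≈ δ (l ℕ.+ p) l
  column-solves-from-l zero = begin
    ∑ 1 (λ t → G q (l ℕ.+ 0) (l ℕ.+ t) * (sign t * total t))  ≈⟨ ∑-one _ ⟩
    G q (l ℕ.+ 0) (l ℕ.+ 0) * (1# * 1#)                       ≈⟨ *-cong (G-diag (l ℕ.+ 0)) (*-identityˡ 1#) ⟩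
    1# * 1#                                                   ≈⟨ *-identityˡ 1# ⟩
    1#                                                        ≡⟨ δ-on (ℕₚ.+-identityʳ l) ⟨
    δ (l ℕ.+ 0) l                                             ∎
  column-solves-from-l (suc p) = begin
    ∑ (suc (suc p)) (λ t → g t * (sign t * total t))
      ≈⟨ ∑-last (suc p) _ ⟩
    ∑ (suc p) (λ t → g t * (sign t * total t)) + g (suc p) * (- sign p * total (suc p))
      ≈⟨ +-cong (∑-cong (suc p) (λ t t<1+p → column-term (ℕₚ.≤-pred t<1+p)))
                (trans (*-congʳ (G-diag (l ℕ.+ suc p))) (trans (*-identityˡ _) (sym (-‿distribˡ-* _ _)))) ⟩
    ∑ (suc p) (λ t → sign p * (coefficient p t * g t)) + - (sign p * total (suc p))
      ≈⟨ +-congʳ (trans (∑-*ˡ (suc p) (sign p) _) (*-congˡ (sym (total-recursion p)))) ⟩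
    sign p * total (suc p) + - (sign p * total (suc p))
      ≈⟨ -‿inverseʳ _ ⟩
    0#
      ≡⟨ δ-off (ℕₚ.m+1+n≢m l) ⟨
    δ (l ℕ.+ suc p) l ∎
    where
    g : ℕ → Carrier
    g t = G q (l ℕ.+ suc p) (l ℕ.+ t)

  column-solves : ∀ i → 1 ≤ i → sumTo (λ m → G q i m * column m) i ≈ δ i l
  column-solves i 1≤i with ℕₚ.<-≤-connex i l
  ... | inj₁ i<l = begin
    sumTo (λ m → G q i m * column m) i
      ≈⟨ sumTo-vanishes i (λ m _ m≤i → trans (*-congˡ (column-below (ℕₚ.≤-<-trans m≤i i<l))) (zeroʳ _)) ⟩
    0#  ≡⟨ δ-off (ℕₚ.<⇒≢ i<l) ⟨
    δ i l ∎
  ... | inj₂ l≤i = ≡.subst (λ i → sumTo (λ m → G q i m * column m) i ≈ δ i l)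
        (ℕₚ.m+[n∸m]≡n l≤i) (from-l (i ∸ l))
    where
    from-l : ∀ p → sumTo (λ m → G q (l ℕ.+ p) m * column m) (l ℕ.+ p) ≈ δ (l ℕ.+ p) l
    from-l p = begin
      sumTo F (l ℕ.+ p)                           ≡⟨ ≡.cong (sumTo F) (ℕₚ.+-suc l₀ p) ⟨
      sumTo F (l₀ ℕ.+ suc p)                      ≈⟨ sumTo-split F l₀ (suc p) ⟩
      sumTo F l₀ + ∑ (suc p) (λ t → F (l ℕ.+ t))
        ≈⟨ +-cong (sumTo-vanishes l₀ (λ m _ m≤l₀ → trans (*-congˡ (column-below (s≤s m≤l₀))) (zeroʳ _)))
                  (∑-cong (suc p) (λ t _ → *-congˡ (column-at t))) ⟩
      0# + ∑ (suc p) (λ t → G q (l ℕ.+ p) (l ℕ.+ t) * (sign t * total t))  ≈⟨ +-identityˡ _ ⟩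
      ∑ (suc p) (λ t → G q (l ℕ.+ p) (l ℕ.+ t) * (sign t * total t))       ≈⟨ column-solves-from-l p ⟩
      δ (l ℕ.+ p) l ∎
      where
      F : ℕ → Carrier
      F m = G q (l ℕ.+ p) m * column m

  H≈column : ∀ m → 1 ≤ m → H m l ≈ column m
  H≈column = unitriangular-unique (G q) G-diag (λ m → H m l) column
    (λ i 1≤i → trans (inv i l 1≤i (s≤s z≤n)) (sym (column-solves i 1≤i)))

  signed-H≈total : ∀ k → l ≤ k → signed (k ∸ l) (H k l) ≈ total (k ∸ l)
  signed-H≈total k l≤k = begin
    signed j (H k l)              ≈⟨ signed≈sign* j (H k l) ⟩
    sign j * H k l                ≈⟨ *-congˡ (H≈column k (ℕₚ.≤-trans (s≤s z≤n) l≤k)) ⟩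
    sign j * column k             ≈⟨ *-congˡ (⟦≤ᵇ⟧*-yes _ l≤k) ⟩
    sign j * (sign j * total j)   ≈⟨ *-assoc _ _ _ ⟨
    (sign j * sign j) * total j   ≈⟨ trans (*-congʳ (sign-square j)) (*-identityˡ _) ⟩
    total j                       ∎
    where
    j : ℕ
    j = k ∸ l

module Walks where
  open Data.Nat using (_+_)
  open ℤ using (+_)

  pt : ℕ → ℕ → Point
  pt x y = + x , + y

  data Step : Set where
    east south : Step

  move : Step → Point → Point
  move east (x , y) = x ℤ.+ ℤ.1ℤ , y
  move south (x , y) = x , y ℤ.- ℤ.1ℤ

  walk after : Point → List Step → List Point
  walk p ss = p ∷ after p ss
  after p [] = []
  after p (s ∷ ss) = walk (move s p) ss

  end : Point → List Step → Point
  end p [] = p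
  end p (s ∷ ss) = end (move s p) ss

  walk-isPath : ∀ p ss → IsPath p (end p ss) (walk p ss)
  walk-isPath p [] = stop p
  walk-isPath p (east ∷ ss) = right (walk-isPath (move east p) ss)
  walk-isPath p (south ∷ ss) = down (walk-isPath (move south p) ss)

  walk-injective : ∀ x y ss ss′ → walk (+ x , y) ss ≡ walk (+ x , y) ss′ → ss ≡ ss′
  walk-injective x y [] [] _ = ≡.refl
  walk-injective x y (east ∷ ss) (east ∷ ss′) eq =
    ≡.cong (east ∷_) (walk-injective (x + 1) y ss ss′ (Listₚ.∷-injectiveʳ eq))
  walk-injective x y (south ∷ ss) (south ∷ ss′) eq =
    ≡.cong (south ∷_) (walk-injective x (y ℤ.- ℤ.1ℤ) ss ss′ (Listₚ.∷-injectiveʳ eq))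
  walk-injective x y (east ∷ _) (south ∷ _) eq =
    ⊥-elim (ℕₚ.m+1+n≢m x (ℤₚ.+-injective (≡.cong proj₁ (Listₚ.∷-injectiveˡ (Listₚ.∷-injectiveʳ eq)))))
  walk-injective x y (south ∷ _) (east ∷ _) eq =
    ⊥-elim (ℕₚ.m+1+n≢m x
          (ℤₚ.+-injective (≡.cong proj₁ (≡.sym (Listₚ.∷-injectiveˡ (Listₚ.∷-injectiveʳ eq))))))

  east^ : ℕ → List Step
  east^ n = replicate n east

  end-east^-run : ∀ x y a rest → end (+ x , y) (east^ a ++ rest) ≡ end (+ (x + a) , y) rest
  end-east^-run x y zero rest = ≡.cong (λ z → end (+ z , y) rest) (≡.sym (ℕₚ.+-identityʳ x))
  end-east^-run x y (suc a) rest =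
    ≡.trans (end-east^-run (x + 1) y a rest) (≡.cong (λ z → end (+ z , y) rest) (ℕₚ.+-assoc x 1 a))

  ∈-east^-run⁻ : ∀ x y a rest {p} → p ∈ walk (+ x , y) (east^ a ++ rest) →
                 (∃[ t ] t < a × p ≡ (+ (x + t) , y)) ⊎ p ∈ walk (+ (x + a) , y) rest
  ∈-east^-run⁻ x y zero rest {p} p∈ = inj₂
        (≡.subst (λ z → p ∈ walk (+ z , y) rest) (≡.sym (ℕₚ.+-identityʳ x)) p∈)
  ∈-east^-run⁻ x y (suc a) rest (here ≡.refl) = inj₁
        (0 , s≤s z≤n , ≡.cong (λ z → (+ z , y)) (≡.sym (ℕₚ.+-identityʳ x)))
  ∈-east^-run⁻ x y (suc a) rest {p} (there p∈) with ∈-east^-run⁻ (x + 1) y a rest p∈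
  ... | inj₁ (t , t<a , ≡.refl) = inj₁ (suc t , s≤s t<a , ≡.cong (λ z → (+ z , y)) (ℕₚ.+-assoc x 1 t))
  ... | inj₂ p∈rest = inj₂ (≡.subst (λ z → p ∈ walk (+ z , y) rest) (ℕₚ.+-assoc x 1 a) p∈rest)

  ∈-east^-run⁺ : ∀ x y a rest t → t ≤ a → (+ (x + t) , y) ∈ walk (+ x , y) (east^ a ++ rest)
  ∈-east^-run⁺ x y a rest zero _ = here (≡.cong (λ z → (+ z , y)) (ℕₚ.+-identityʳ x))
  ∈-east^-run⁺ x y (suc a) rest (suc t) (s≤s t≤a) =
    there (≡.subst (λ z → (+ z , y) ∈ walk (+ (x + 1) , y) (east^ a ++ rest)) (ℕₚ.+-assoc x 1 t)
                   (∈-east^-run⁺ (x + 1) y a rest t t≤a))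

  ∈-east^-rest⁺ : ∀ x y a rest {p} → p ∈ walk (+ (x + a) , y) rest → p ∈ walk (+ x , y) (east^ a ++ rest)
  ∈-east^-rest⁺ x y zero rest {p} p∈ = ≡.subst (λ z → p ∈ walk (+ z , y) rest) (ℕₚ.+-identityʳ x) p∈
  ∈-east^-rest⁺ x y (suc a) rest {p} p∈ =
    there (∈-east^-rest⁺ (x + 1) y a rest (≡.subst (λ z → p ∈ walk (+ z , y) rest) (≡.sym (ℕₚ.+-assoc x 1 a)) p∈))

  ∈-east^⁻ : ∀ x y a {p} → p ∈ walk (+ x , y) (east^ a) → ∃[ t ] p ≡ (+ (x + t) , y)
  ∈-east^⁻ x y zero (here ≡.refl) = 0 , ≡.cong (λ z → (+ z , y)) (≡.sym (ℕₚ.+-identityʳ x))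
  ∈-east^⁻ x y (suc a) (here ≡.refl) = 0 , ≡.cong (λ z → (+ z , y)) (≡.sym (ℕₚ.+-identityʳ x))
  ∈-east^⁻ x y (suc a) (there p∈) with ∈-east^⁻ (x + 1) y a p∈
  ... | t , ≡.refl = suc t , ≡.cong (λ z → (+ z , y)) (ℕₚ.+-assoc x 1 t)

  end-east^ : ∀ x y a → end (+ x , y) (east^ a) ≡ (+ (x + a) , y)
  end-east^ x y zero = ≡.cong (λ z → (+ z , y)) (≡.sym (ℕₚ.+-identityʳ x))
  end-east^ x y (suc a) = ≡.trans (end-east^ (x + 1) y a) (≡.cong (λ z → (+ z , y)) (ℕₚ.+-assoc x 1 a))

  southArea : ℕ → List Step → ℕ
  southArea n [] = 0
  southArea n (east ∷ ss) = southArea (suc n) ss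
  southArea n (south ∷ ss) = n + southArea n ss

  southArea-east^ : ∀ n a rest → southArea n (east^ a ++ rest) ≡ southArea (a + n) rest
  southArea-east^ n zero rest = ≡.refl
  southArea-east^ n (suc a) rest = ≡.trans (southArea-east^ (suc n) a rest) (≡.cong (λ z → southArea z rest) (ℕₚ.+-suc a n))

  southArea-flat : ∀ n a → southArea n (east^ a) ≡ 0
  southArea-flat n zero = ≡.refl
  southArea-flat n (suc a) = southArea-flat (suc n) a

  lamAux-walk : ∀ x₀ n y ss → lamAux (+ x₀) (walk (+ (x₀ + n) , y) ss) ≡ + southArea n ss
  lamAux-walk x₀ n y [] = ≡.refl
  lamAux-walk x₀ n y (east ∷ ss)
    rewrite dec-false ((+ (x₀ + n + 1) , y) ≟P (+ (x₀ + n) , y ℤ.- ℤ.1ℤ))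
                      (λ e → ℕₚ.m+1+n≢m (x₀ + n) (ℤₚ.+-injective (≡.cong proj₁ e)))
          | ℕₚ.+-assoc x₀ n 1 | ℕₚ.+-comm n 1 = ≡.trans (ℤₚ.+-identityˡ _) (lamAux-walk x₀ (suc n) y ss)
  lamAux-walk x₀ n y (south ∷ ss)
    rewrite dec-true ((+ (x₀ + n) , y ℤ.- ℤ.1ℤ) ≟P (+ (x₀ + n) , y ℤ.- ℤ.1ℤ)) ≡.refl
          | lamAux-walk x₀ n (y ℤ.- ℤ.1ℤ) ss
          | ℤₚ.m-n≡m⊖n (x₀ + n) x₀ | ℤₚ.⊖-≥ (ℕₚ.m≤m+n x₀ n) | ℕₚ.m+n∸m≡n x₀ n = ≡.refl

  lam-walk : ∀ x₀ y ss → lam (walk (+ x₀ , y) ss) ≡ southArea 0 ss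
  lam-walk x₀ y ss =
    ≡.cong ℤ.∣_∣ (≡.trans (≡.cong (λ z → lamAux (+ x₀) (walk (+ z , y) ss)) (≡.sym (ℕₚ.+-identityʳ x₀)))
                          (lamAux-walk x₀ 0 y ss))

  rows-descend : ∀ {s t w} → IsPath s t w → proj₂ t ℤ.≤ proj₂ s
  rows-descend (stop p) = ℤₚ.≤-refl
  rows-descend (right p) = rows-descend p
  rows-descend (down p) = ℤₚ.≤-trans (rows-descend p) (ℤₚ.i≤j⇒i-k≤j (+ 1) ℤₚ.≤-refl)

  flat-shape : ∀ {x y x′ w} → IsPath (+ x , y) (+ x′ , y) w →
               Σ[ a ∈ ℕ ] w ≡ walk (+ x , y) (east^ a) × x + a ≡ x′
  flat-shape {x} (stop _) = 0 , ≡.refl , ℕₚ.+-identityʳ x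
  flat-shape {x} (right p) with flat-shape p
  ... | a , ≡.refl , x+1+a≡x′ = suc a , ≡.refl , ≡.trans (≡.sym (ℕₚ.+-assoc x 1 a)) x+1+a≡x′
  flat-shape {x} {y} (down p) = ⊥-elim (ℤₚ.<-irrefl ≡.refl (ℤₚ.i≤pred[j]⇒i<j
    (≡.subst (y ℤ.≤_) (ℤₚ.+-comm y ℤ.-1ℤ) (rows-descend p))))

  oneSouth-shape : ∀ {x y x′ w} → IsPath (+ x , + suc y) (+ x′ , + y) w →
                   Σ[ g ∈ ℕ ] Σ[ c ∈ ℕ ] w ≡ walk (+ x , + suc y) (east^ g ++ south ∷ east^ c) × x + g + c ≡ x′
  oneSouth-shape {x} (right p) with oneSouth-shape p
  ... | g , c , ≡.refl , sum≡x′ = suc g , c , ≡.refl , ≡.trans (≡.cong (_+ c) (≡.sym (ℕₚ.+-assoc x 1 g))) sum≡x′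
  oneSouth-shape {x} (down p) with flat-shape p
  ... | c , ≡.refl , sum≡x′ = 0 , c , ≡.refl , ≡.trans (≡.cong (_+ c) (ℕₚ.+-identityʳ x)) sum≡x′

  twoSouth-shape : ∀ {x y x′ w} → IsPath (+ x , + suc (suc y)) (+ x′ , + y) w →
                   Σ[ a ∈ ℕ ] Σ[ g ∈ ℕ ] Σ[ c ∈ ℕ ]
                   w ≡ walk (+ x , + suc (suc y)) (east^ a ++ south ∷ east^ g ++ south ∷ east^ c) × x + a + g + c ≡ x′
  twoSouth-shape {x} (right p) with twoSouth-shape p
  ... | a , g , c , ≡.refl , sum≡x′ =
    suc a , g , c , ≡.refl , ≡.trans (≡.cong (λ z → z + g + c) (≡.sym (ℕₚ.+-assoc x 1 a))) sum≡x′
  twoSouth-shape {x} (down p) with oneSouth-shape p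
  ... | g , c , ≡.refl , sum≡x′ = 0 , g , c , ≡.refl ,
        ≡.trans (≡.cong (λ z → z + g + c) (ℕₚ.+-identityʳ x)) sum≡x′

module FamilyPaths where
  open Data.Nat using (_+_)
  open ℤ using (+_)
  open Walks

  level : ℕ → ℕ
  level i = 2 ℕ.* i ∸ 1

  level-suc : ∀ {i} → 1 ≤ i → level (suc i) ≡ 2 + level i
  level-suc {suc i} _ = lemma i
    where
    lemma : ∀ i → suc (i + suc (suc (i + 0))) ≡ suc (suc (i + suc (i + 0)))
    lemma = solve-∀

  level-as-sum : ∀ {i} → 1 ≤ i → i + (i ∸ 1) ≡ level i
  level-as-sum {suc i} _ = lemma i
    where
    lemma : ∀ i → suc (i + i) ≡ i + suc (i + 0)
    lemma = solve-∀

  level-mono : ∀ {i i′} → i ≤ i′ → level i ≤ level i′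
  level-mono i≤i′ = ℕₚ.∸-monoˡ-≤ 1 (ℕₚ.*-monoʳ-≤ 2 i≤i′)

  level-gap : ∀ {i i′} → 1 ≤ i → i < i′ → 2 + level i ≤ level i′
  level-gap 1≤i i<i′ = ℕₚ.≤-trans (ℕₚ.≤-reflexive (≡.sym (level-suc 1≤i))) (level-mono i<i′)

  A-suc : ∀ {i} → 1 ≤ i → A (suc i) ≡ pt i (2 + level i)
  A-suc {i} 1≤i = ≡.cong (λ y → pt i y) (level-suc 1≤i)

  flatPath : ℕ → List Point
  flatPath i = walk (A i) (east^ i)

  moverSteps : ℕ → ℕ → ℕ → List Step
  moverSteps i a b = east^ a ++ south ∷ east^ (b ∸ a) ++ south ∷ east^ (i ∸ 1 ∸ b)

  moverPath : ℕ → ℕ → ℕ → List Point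
  moverPath i a b = walk (pt i (2 + level i)) (moverSteps i a b)

  flat-isPath : ∀ {i} → 1 ≤ i → IsPath (A i) (B i) (flatPath i)
  flat-isPath {suc i} 1≤i = ≡.subst (λ t → IsPath (A (suc i)) t (flatPath (suc i)))
    (≡.trans (end-east^ i _ (suc i))
        (≡.cong (λ x → + x , + level (suc i)) (≡.trans (ℕₚ.+-comm i (suc i)) (level-as-sum 1≤i))))
    (walk-isPath (A (suc i)) (east^ (suc i)))

  flat-unique : ∀ {i w} → 1 ≤ i → IsPath (A i) (B i) w → w ≡ flatPath i
  flat-unique {suc i} 1≤i p with flat-shape p
  ... | a , ≡.refl , i+a≡level = ≡.cong (λ a → walk (A (suc i)) (east^ a))
    (ℕₚ.+-cancelˡ-≡ i a (suc i) (≡.trans i+a≡level (≡.sym (≡.trans (ℕₚ.+-comm i (suc i)) (level-as-sum 1≤i)))))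

  lam-flat : ∀ i → lam (flatPath i) ≡ 0
  lam-flat i = ≡.trans (lam-walk (i ∸ 1) _ (east^ i)) (southArea-flat 0 i)

  mover-isPath : ∀ {i a b} → a ≤ b → b < i → IsPath (A (suc i)) (B i) (moverPath i a b)
  mover-isPath {i} {a} {b} a≤b b<i = ≡.subst₂ (λ s t → IsPath s t (moverPath i a b)) (≡.sym (A-suc 1≤i)) end≡B
    (walk-isPath (pt i (2 + level i)) (moverSteps i a b))
    where
    1≤i : 1 ≤ i
    1≤i = ℕₚ.<-≤-trans (s≤s z≤n) b<i
    abscissa : i + a + (b ∸ a) + (i ∸ 1 ∸ b) ≡ level i
    abscissa = begin
      i + a + (b ∸ a) + (i ∸ 1 ∸ b)
        ≡⟨ ≡.cong (_+ (i ∸ 1 ∸ b)) (≡.trans (ℕₚ.+-assoc i a _) (≡.cong (λ z → i + z) (ℕₚ.m+[n∸m]≡n a≤b))) ⟩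
      i + b + (i ∸ 1 ∸ b)
        ≡⟨ ≡.trans (ℕₚ.+-assoc i b _) (≡.cong (λ z → i + z) (ℕₚ.m+[n∸m]≡n (ℕₚ.∸-monoˡ-≤ 1 b<i))) ⟩
      i + (i ∸ 1)                    ≡⟨ level-as-sum 1≤i ⟩
      level i                        ∎
      where
      open ≡.≡-Reasoning
    end≡B : end (pt i (2 + level i)) (moverSteps i a b) ≡ B i
    end≡B = ≡.trans (end-east^-run i _ a _) (≡.trans (end-east^-run (i + a) _ (b ∸ a) _)
              (≡.trans (end-east^ (i + a + (b ∸ a)) _ (i ∸ 1 ∸ b)) (≡.cong (λ x → + x , + level i) abscissa)))

  mover-unique : ∀ {i w} → 1 ≤ i → IsPath (A (suc i)) (B i) w →
                 Σ[ a ∈ ℕ ] Σ[ b ∈ ℕ ] a ≤ b × b < i × w ≡ moverPath i a b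
  mover-unique {suc i} {w} 1≤i p with twoSouth-shape (≡.subst (λ s → IsPath s (B (suc i)) w) (A-suc 1≤i) p)
  ... | a , g , c , ≡.refl , abscissa =
    a , a + g , ℕₚ.m≤m+n a g , s≤s (≡.subst (a + g ≤_) runs (ℕₚ.m≤m+n (a + g) c)) , ≡.cong (walk _) steps
    where
    runs : a + g + c ≡ i
    runs = ℕₚ.+-cancelˡ-≡ (suc i) _ _ (≡.trans (reassoc (suc i) a g c) (≡.trans abscissa (≡.sym (level-as-sum 1≤i))))
      where
      reassoc : ∀ i a g c → i + (a + g + c) ≡ i + a + g + c
      reassoc = solve-∀
    steps : east^ a ++ south ∷ east^ g ++ south ∷ east^ c ≡ moverSteps (suc i) a (a + g)
    steps = ≡.cong₂ (λ u v → east^ a ++ south ∷ east^ u ++ south ∷ east^ v)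
                    (≡.sym (ℕₚ.m+n∸m≡n a g))
                    (≡.sym (≡.trans (≡.cong (_∸ (a + g)) (≡.sym runs)) (ℕₚ.m+n∸m≡n (a + g) c)))

  lam-mover : ∀ i {a b} → a ≤ b → lam (moverPath i a b) ≡ a + b
  lam-mover i {a} {b} a≤b = begin
    lam (moverPath i a b)                        ≡⟨ lam-walk i _ (moverSteps i a b) ⟩
    southArea 0 (moverSteps i a b)               ≡⟨ southArea-east^ 0 a _ ⟩
    a + 0 + southArea (a + 0) (east^ (b ∸ a) ++ south ∷ east^ c)
      ≡⟨ ≡.cong (λ z → a + 0 + z) (southArea-east^ (a + 0) (b ∸ a) _) ⟩
    a + 0 + (b ∸ a + (a + 0) + southArea (b ∸ a + (a + 0)) (east^ c))
      ≡⟨ ≡.cong (λ z → a + 0 + (b ∸ a + (a + 0) + z)) (southArea-flat _ c) ⟩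
    a + 0 + (b ∸ a + (a + 0) + 0)
      ≡⟨ ≡.cong₂ _+_ (ℕₚ.+-identityʳ a) (≡.trans (ℕₚ.+-identityʳ _)
           (≡.trans (≡.cong (λ z → b ∸ a + z) (ℕₚ.+-identityʳ a)) (ℕₚ.m∸n+n≡m a≤b))) ⟩
    a + b                                        ∎
    where
    open ≡.≡-Reasoning
    c : ℕ
    c = i ∸ 1 ∸ b

  east^-south-injective : ∀ a a′ rest rest′ → east^ a ++ south ∷ rest ≡ east^ a′ ++ south ∷ rest′ →
                          a ≡ a′ × rest ≡ rest′
  east^-south-injective zero zero rest rest′ eq = ≡.refl , Listₚ.∷-injectiveʳ eq
  east^-south-injective (suc a) (suc a′) rest rest′ eq
      with east^-south-injective a a′ rest rest′ (Listₚ.∷-injectiveʳ eq)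
  ... | ≡.refl , rest≡rest′ = ≡.refl , rest≡rest′

  mover-injective : ∀ {i a b a′ b′} → a ≤ b → a′ ≤ b′ → moverPath i a b ≡ moverPath i a′ b′ →
                    a ≡ a′ × b ≡ b′
  mover-injective {i} {a} {b} {a′} {b′} a≤b a′≤b′ eq
    with east^-south-injective a a′ _ _ (walk-injective i _ _ _ eq)
  ... | ≡.refl , rest≡rest′ with east^-south-injective (b ∸ a) (b′ ∸ a) _ _ rest≡rest′
  ... | b-a≡b′-a , _ = ≡.refl ,
      ≡.trans (≡.sym (ℕₚ.m∸n+n≡m a≤b)) (≡.trans (≡.cong (_+ a) b-a≡b′-a) (ℕₚ.m∸n+n≡m a′≤b′))

  data Shape : Set where
    flat : Shape
    mover : ℕ → ℕ → Shape

  draw : ℕ → Shape → List Point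
  draw i flat = flatPath i
  draw i (mover a b) = moverPath i a b

  data OnPath (i : ℕ) : Shape → ℕ → ℕ → Set where
    flat-row   : ∀ {X Z} → Z ≡ level i → OnPath i flat X Z
    top-row    : ∀ {a b X Z} → Z ≡ 2 + level i → X ≤ i + a → OnPath i (mover a b) X Z
    middle-row : ∀ {a b X Z} → Z ≡ 1 + level i → OnPath i (mover a b) X Z
    bottom-row : ∀ {a b X Z} → Z ≡ level i → i + b ≤ X → OnPath i (mover a b) X Z

  on-draw : ∀ i s {p} → p ∈ draw i s → Σ[ X ∈ ℕ ] Σ[ Z ∈ ℕ ] p ≡ pt X Z × OnPath i s X Z
  on-draw i flat p∈ with ∈-east^⁻ (i ∸ 1) (+ level i) i p∈
  ... | t , p≡ = i ∸ 1 + t , level i , p≡ , flat-row ≡.refl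
  on-draw i (mover a b) p∈ with ∈-east^-run⁻ i (+ (2 + level i)) a _ p∈
  ... | inj₁ (t , t<a , p≡) = i + t , 2 + level i , p≡ , top-row ≡.refl (ℕₚ.+-monoʳ-≤ i (ℕₚ.<⇒≤ t<a))
  ... | inj₂ (here p≡) = i + a , 2 + level i , p≡ , top-row ≡.refl ℕₚ.≤-refl
  ... | inj₂ (there p∈₂) with ∈-east^-run⁻ (i + a) (+ (1 + level i)) (b ∸ a) _ p∈₂
  ...   | inj₁ (t , _ , p≡) = i + a + t , 1 + level i , p≡ , middle-row ≡.refl
  ...   | inj₂ (here p≡) = i + a + (b ∸ a) , 1 + level i , p≡ , middle-row ≡.refl
  ...   | inj₂ (there p∈₃) with ∈-east^⁻ (i + a + (b ∸ a)) (+ level i) (i ∸ 1 ∸ b) p∈₃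
  ...     | t , p≡ = i + a + (b ∸ a) + t , level i , p≡ , bottom-row ≡.refl
                     (ℕₚ.≤-trans start (ℕₚ.m≤m+n _ t))
    where
    start : i + b ≤ i + a + (b ∸ a)
    start = ℕₚ.≤-trans (ℕₚ.+-monoʳ-≤ i (ℕₚ.m≤n+m∸n b a))
        (ℕₚ.≤-reflexive (≡.sym (ℕₚ.+-assoc i a (b ∸ a))))

  OnPath-rows : ∀ {i s X Z} → OnPath i s X Z → level i ≤ Z × Z ≤ 2 + level i
  OnPath-rows {i} (flat-row ≡.refl) = ℕₚ.≤-refl , ℕₚ.m≤n+m (level i) 2
  OnPath-rows {i} (top-row ≡.refl _) = ℕₚ.m≤n+m (level i) 2 , ℕₚ.≤-refl
  OnPath-rows {i} (middle-row ≡.refl) = ℕₚ.m≤n+m (level i) 1 , ℕₚ.n≤1+n _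
  OnPath-rows {i} (bottom-row ≡.refl _) = ℕₚ.≤-refl , ℕₚ.m≤n+m (level i) 2

  -- The top row of a mover γ_i is the bottom row of γ_{i+1}, and it starts at A_{i+1}, so
  -- γ_{i+1} cannot be flat and, if it is a mover, must enter that row after γ_i has left it.
  Stacks : Shape → Shape → Set
  Stacks flat _ = ⊤
  Stacks (mover a b) flat = ⊥
  Stacks (mover a b) (mover a′ b′) = a ≤ b′

  draws-disjoint : ∀ {i i′ s s′} → 1 ≤ i → i < i′ → (i′ ≡ suc i → Stacks s s′) →
                   Disjoint (draw i s) (draw i′ s′)
  draws-disjoint {i} {i′} {s} {s′} 1≤i i<i′ stacks p p∈ p∈′
    with on-draw i s p∈ | on-draw i′ s′ p∈′
  ... | X , Z , ≡.refl , on | X′ , Z′ , p≡′ , on′ with p≡′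
  ... | ≡.refl = rows on on′
    where
    lift : level (suc i) ≡ 2 + level i
    lift = level-suc 1≤i
    rows : OnPath i s X Z → OnPath i′ s′ X Z → ⊥
    rows on on′ with ℕₚ.m≤n⇒m<n∨m≡n i<i′
    ... | inj₁ 2+i≤i′ = ℕₚ.<⇒≱ (ℕₚ.m<n+m (level (suc i)) {2} (s≤s z≤n))
      (ℕₚ.≤-trans (level-gap (s≤s z≤n) 2+i≤i′)
                  (ℕₚ.≤-trans (proj₁ (OnPath-rows on′))
                        (ℕₚ.≤-trans (proj₂ (OnPath-rows on)) (ℕₚ.≤-reflexive (≡.sym lift)))))
    ... | inj₂ ≡.refl = touching on on′ (stacks ≡.refl)
      where
      above : 2 + level i ≤ Z
      above = ℕₚ.≤-trans (level-gap 1≤i i<i′) (proj₁ (OnPath-rows on′))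
      touching : OnPath i s X Z → OnPath (suc i) s′ X Z → Stacks s s′ → ⊥
      touching (flat-row ≡.refl) _ _ = ℕₚ.<⇒≱ (ℕₚ.m<n+m (level i) {2} (s≤s z≤n)) above
      touching (middle-row ≡.refl) _ _ = ℕₚ.<⇒≱ (ℕₚ.m<n+m (level i) {1} (s≤s z≤n)) (ℕₚ.≤-pred above)
      touching (bottom-row ≡.refl _) _ _ = ℕₚ.<⇒≱ (ℕₚ.m<n+m (level i) {2} (s≤s z≤n)) above
      touching (top-row _ _) (flat-row _) ()
      touching (top-row ≡.refl _) (top-row Z≡ _) _ =
        ℕₚ.<⇒≱ (ℕₚ.m<n+m (2 + level i) {2} (s≤s z≤n))
            (ℕₚ.≤-reflexive (≡.trans (≡.cong (λ z → 2 + z) (≡.sym lift)) (≡.sym Z≡)))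
      touching (top-row ≡.refl _) (middle-row Z≡) _ =
        ℕₚ.<⇒≱ (ℕₚ.m<n+m (2 + level i) {1} (s≤s z≤n))
            (ℕₚ.≤-reflexive (≡.trans (≡.cong (λ z → 1 + z) (≡.sym lift)) (≡.sym Z≡)))
      touching (top-row _ X≤i+a) (bottom-row _ 1+i+b′≤X) a≤b′ =
        ℕₚ.<⇒≱ (s≤s (ℕₚ.+-monoʳ-≤ i a≤b′)) (ℕₚ.≤-trans 1+i+b′≤X X≤i+a)

  stacked-if-disjoint : ∀ {i a b a′ b′} → 1 ≤ i → a′ ≤ b′ →
                        Disjoint (moverPath i a b) (moverPath (suc i) a′ b′) → a ≤ b′
  stacked-if-disjoint {i} {a} {b} {a′} {b′} 1≤i a′≤b′ disjoint with ℕₚ.≤-<-connex a b′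
  ... | inj₁ a≤b′ = a≤b′
  ... | inj₂ b′<a = ⊥-elim (disjoint (pt (suc i + b′) (2 + level i)) on-top on-bottom)
    where
    on-top : pt (suc i + b′) (2 + level i) ∈ moverPath i a b
    on-top = ≡.subst (λ x → pt x (2 + level i) ∈ moverPath i a b) (ℕₚ.+-suc i b′)
                     (∈-east^-run⁺ i _ a _ (suc b′) b′<a)
    corner : pt (suc i + b′) (2 + level i) ≡ pt (suc i + a′ + (b′ ∸ a′)) (level (suc i))
    corner = ≡.cong₂ pt (≡.trans (≡.cong (λ z → suc i + z) (≡.sym (ℕₚ.m+[n∸m]≡n a′≤b′)))
          (≡.sym (ℕₚ.+-assoc (suc i) a′ _)))
                        (≡.sym (level-suc 1≤i))
    on-bottom : pt (suc i + b′) (2 + level i) ∈ moverPath (suc i) a′ b′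
    on-bottom = ∈-east^-rest⁺ (suc i) _ a′ _ (there (∈-east^-rest⁺ (suc i + a′) _ (b′ ∸ a′) _ (there (here corner))))

module Families (l₀ j m : ℕ) where
  open Data.Nat using (_+_)
  open FamilyPaths

  l k n : ℕ
  l = suc l₀
  k = l + j
  n = k + m

  range : ℕ → ℕ → List ℕ
  range s c = applyUpTo (λ i → s + i) c

  range-suc : ∀ s c → range s (suc c) ≡ s ∷ range (suc s) c
  range-suc s c = ≡.cong₂ _∷_ (ℕₚ.+-identityʳ s) (applyUpTo-cong c (ℕₚ.+-suc s))

  range-++ : ∀ s a b → range s (a + b) ≡ range s a ++ range (s + a) b
  range-++ s a b = ≡.trans (applyUpTo-++ _ a b)
    (≡.cong (range s a ++_) (applyUpTo-cong b (λ i → ≡.sym (ℕₚ.+-assoc s a i))))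

  ∈-range⁻ : ∀ s c {i} → i ∈ range s c → s ≤ i × i < s + c
  ∈-range⁻ s c i∈ with ∈-applyUpTo⁻ (λ i → s + i) i∈
  ... | t , t<c , ≡.refl = ℕₚ.m≤m+n s t , ℕₚ.+-monoʳ-< s t<c

  indices-split : indices n k ≡ range 1 l₀ ++ range l j ++ range (suc k) m
  indices-split = begin
    filterᵇ keep (map suc (upTo n))                      ≡⟨ ≡.cong (filterᵇ keep) (Listₚ.map-upTo suc n) ⟩
    filterᵇ keep (range 1 n)                             ≡⟨ ≡.cong (λ z → filterᵇ keep (range 1 z)) (total l₀ j m) ⟩
    filterᵇ keep (range 1 (l₀ + (j + suc m)))           ≡⟨ ≡.cong (filterᵇ keep) split ⟩
    filterᵇ keep (range 1 l₀ ++ range l j ++ k ∷ range (suc k) m)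
      ≡⟨ Listₚ.filter-++ keep? (range 1 l₀) _ ⟩
    filterᵇ keep (range 1 l₀) ++ filterᵇ keep (range l j ++ k ∷ range (suc k) m)
      ≡⟨ ≡.cong (filterᵇ keep (range 1 l₀) ++_) (Listₚ.filter-++ keep? (range l j) _) ⟩
    filterᵇ keep (range 1 l₀) ++ filterᵇ keep (range l j) ++ filterᵇ keep (k ∷ range (suc k) m)
      ≡⟨ ≡.cong₂ _++_ (Listₚ.filter-all keep?
            (kept (λ i∈ → ℕₚ.<⇒≢ (ℕₚ.<-≤-trans (proj₂ (∈-range⁻ 1 l₀ i∈)) (ℕₚ.m≤m+n l j)))))
           (≡.cong₂ _++_ (Listₚ.filter-all keep? (kept (λ i∈ → ℕₚ.<⇒≢ (proj₂ (∈-range⁻ l j i∈)))))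
             (≡.trans (Listₚ.filter-reject keep? {k} dropped)
                      (Listₚ.filter-all keep? (kept (λ i∈ → ℕₚ.>⇒≢ (proj₁ (∈-range⁻ (suc k) m i∈))))))) ⟩
    range 1 l₀ ++ range l j ++ range (suc k) m           ∎
    where
    open ≡.≡-Reasoning
    keep : ℕ → Bool
    keep i = not (i ≡ᵇ k)
    keep? : ∀ i → Dec (T (keep i))
    keep? i = T? (keep i)
    kept : ∀ {xs} → (∀ {i} → i ∈ xs → i ≢ k) → All (λ i → T (keep i)) xs
    kept ≢k = All.tabulate (λ i∈ → ≡.subst (λ b → T (not b)) (≡.sym (≡ᵇ-no (≢k i∈))) tt)
    dropped : ¬ T (keep k)
    dropped rewrite ≡ᵇ-yes {k} ≡.refl = λ ()
    total : ∀ l₀ j m → suc l₀ + j + m ≡ l₀ + (j + suc m)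
    total = solve-∀
    split : range 1 (l₀ + (j + suc m)) ≡ range 1 l₀ ++ range l j ++ k ∷ range (suc k) m
    split = ≡.trans (range-++ 1 l₀ _) (≡.cong (range 1 l₀ ++_)
              (≡.trans (range-++ l j (suc m)) (≡.cong (range l j ++_) (range-suc k m))))

  src-below : ∀ {i} → i < l → src k l i ≡ A i
  src-below i<l rewrite ≤ᵇ-no i<l = ≡.refl

  src-above : ∀ {i} → k < i → src k l i ≡ A i
  src-above k<i rewrite ≤ᵇ-yes (ℕₚ.≤-trans (ℕₚ.m≤m+n l j) (ℕₚ.<⇒≤ k<i))
        | ≤ᵇ-yes (ℕₚ.<⇒≤ k<i) = ≡.refl

  src-between : ∀ {i} → l ≤ i → i < k → src k l i ≡ A (suc i)
  src-between l≤i i<k rewrite ≤ᵇ-yes l≤i | ≤ᵇ-no i<k = ≡.refl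

  PathAt : ℕ → List Point → Set
  PathAt i w = IsPath (src k l i) (B i) w

  -- Admissible p cap c: c lists (a_l , b_l) , … , (a_{l+p-1} , b_{l+p-1}) with a_i ≤ b_i < i,
  -- a_i ≤ b_{i+1}, and a_{l+p-1} ≤ cap.
  data Admissible : ℕ → ℕ → List (ℕ × ℕ) → Set where
    []     : ∀ {cap} → Admissible 0 cap []
    extend : ∀ {p cap a b c} → a ≤ cap → a ≤ b → b < l + p → Admissible p b c →
             Admissible (suc p) cap (c ∷ʳ (a , b))

  admissible-length : ∀ {p cap c} → Admissible p cap c → length c ≡ p
  admissible-length [] = ≡.refl
  admissible-length (extend {c = c} _ _ _ adm) =
    ≡.trans (Listₚ.length-++ c) (≡.trans (ℕₚ.+-comm _ 1) (≡.cong suc (admissible-length adm)))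

  admissible-weaken : ∀ {p cap cap′ c} → cap ≤ cap′ → Admissible p cap c → Admissible p cap′ c
  admissible-weaken cap≤ [] = []
  admissible-weaken cap≤ (extend a≤cap a≤b b<l+p adm) = extend (ℕₚ.≤-trans a≤cap cap≤) a≤b b<l+p adm

  admissible-ordered : ∀ {p cap c} → Admissible p cap c → All (λ x → proj₁ x ≤ proj₂ x) c
  admissible-ordered [] = []
  admissible-ordered (extend _ a≤b _ adm) = Allₚ.∷ʳ⁺ (admissible-ordered adm) a≤b

  flats : ℕ → ℕ → List (ℕ × Shape)
  flats s c = map (λ i → i , flat) (range s c)

  movers : ℕ → List (ℕ × ℕ) → List (ℕ × Shape)
  movers i [] = []
  movers i ((a , b) ∷ c) = (i , mover a b) ∷ movers (suc i) c

  movers-∷ʳ : ∀ i c a b → movers i (c ∷ʳ (a , b)) ≡ movers i c ∷ʳ (i + length c , mover a b)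
  movers-∷ʳ i [] a b = ≡.cong (λ x → (x , mover a b) ∷ []) (≡.sym (ℕₚ.+-identityʳ i))
  movers-∷ʳ i ((a′ , b′) ∷ c) a b = ≡.cong ((i , mover a′ b′) ∷_)
    (≡.trans (movers-∷ʳ (suc i) c a b)
        (≡.cong (λ x → movers (suc i) c ∷ʳ (x , mover a b)) (≡.sym (ℕₚ.+-suc i (length c)))))

  family : List (ℕ × ℕ) → List (ℕ × Shape)
  family c = flats 1 l₀ ++ movers l c ++ flats (suc k) m

  encode : List (ℕ × ℕ) → List (List Point)
  encode c = map (uncurry draw) (family c)

  family-indices : ∀ c → length c ≡ j → map proj₁ (family c) ≡ indices n k
  family-indices c len = begin
    map proj₁ (family c)   ≡⟨ Listₚ.map-++ proj₁ (flats 1 l₀) _ ⟩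
    map proj₁ (flats 1 l₀) ++ map proj₁ (movers l c ++ flats (suc k) m)
      ≡⟨ ≡.cong₂ _++_ (flat-indices 1 l₀) (≡.trans (Listₚ.map-++ proj₁ (movers l c) _)
                                            (≡.cong₂ _++_ (≡.trans (mover-indices l c) (≡.cong (range l) len))
                                                (flat-indices (suc k) m))) ⟩
    range 1 l₀ ++ range l j ++ range (suc k) m  ≡⟨ indices-split ⟨
    indices n k ∎
    where
    open ≡.≡-Reasoning
    flat-indices : ∀ s c → map proj₁ (flats s c) ≡ range s c
    flat-indices s c = ≡.trans (≡.sym (Listₚ.map-∘ (range s c))) (Listₚ.map-id (range s c))
    mover-indices : ∀ i c → map proj₁ (movers i c) ≡ range i (length c)
    mover-indices i [] = ≡.refl
    mover-indices i ((a , b) ∷ c) = ≡.trans (≡.cong (i ∷_) (mover-indices (suc i) c)) (≡.sym (range-suc i (length c)))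

  Compatible : ℕ × Shape → ℕ × Shape → Set
  Compatible (i , s) (i′ , s′) = 1 ≤ i × i < i′ × (i′ ≡ suc i → Stacks s s′)

  Middle : ℕ → ℕ × Shape → Set
  Middle p (i , flat) = ⊥
  Middle p (i , mover a b) = l ≤ i × i < l + p × a ≤ b × b < i

  movers-middle : ∀ {p cap c} → Admissible p cap c → All (Middle p) (movers l c)
  movers-middle [] = []
  movers-middle {suc p} (extend {a = a} {b = b} {c = c} _ a≤b b<l+p adm) rewrite movers-∷ʳ l c a b | admissible-length adm =
    Allₚ.∷ʳ⁺ (All.map widen (movers-middle adm)) (ℕₚ.m≤m+n l p , ℕₚ.+-monoʳ-< l (ℕₚ.n<1+n p) , a≤b , b<l+p)
    where
    widen : ∀ {d} → Middle p d → Middle (suc p) d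
    widen {i , mover _ _} (l≤i , i<l+p , a≤b , b<i) =
        l≤i , ℕₚ.<-trans i<l+p (ℕₚ.+-monoʳ-< l (ℕₚ.n<1+n p)) , a≤b , b<i

  movers-compatible : ∀ {p cap c} → Admissible p cap c → ∀ a′ →
                      All (λ d → Compatible d (l + p , mover a′ cap)) (movers l c)
  movers-compatible [] a′ = []
  movers-compatible {suc p} {cap} (extend {a = a} {b = b} {c = c} a≤cap _ _ adm) a′
        rewrite movers-∷ʳ l c a b | admissible-length adm =
    Allₚ.∷ʳ⁺ (All.map further (movers-compatible adm a))
        (ℕₚ.≤-trans (s≤s z≤n) (ℕₚ.m≤m+n l p) , next , λ _ → a≤cap)
    where
    next : l + p < l + suc p
    next = ℕₚ.+-monoʳ-< l (ℕₚ.n<1+n p)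
    further : ∀ {d} → Compatible d (l + p , mover a b) → Compatible d (l + suc p , mover a′ cap)
    further {i , _} (1≤i , i<l+p , _) = 1≤i , ℕₚ.<-trans i<l+p next ,
      λ l+1+p≡1+i → ⊥-elim (ℕₚ.<-irrefl
            (≡.sym (ℕₚ.suc-injective (≡.trans (≡.sym (ℕₚ.+-suc l p)) l+1+p≡1+i))) i<l+p)

  movers-pairwise : ∀ {p cap c} → Admissible p cap c → AllPairs Compatible (movers l c)
  movers-pairwise [] = []
  movers-pairwise (extend {a = a} {b = b} {c = c} _ _ _ adm) rewrite movers-∷ʳ l c a b | admissible-length adm =
    AllPairsₚ.++⁺ (movers-pairwise adm) ([] ∷ []) (All.map (_∷ []) (movers-compatible adm a))

  flats-all : ∀ {P : ℕ × Shape → Set} s c → (∀ t → t < c → P (s + t , flat)) → All P (flats s c)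
  flats-all s c P-at = Allₚ.map⁺ (Allₚ.applyUpTo⁺₁ _ c (λ {t} → P-at t))

  flats-pairwise : ∀ s c → AllPairs Compatible (flats (suc s) c)
  flats-pairwise s c =
    AllPairsₚ.map⁺ (AllPairsₚ.applyUpTo⁺₁ _ c
          (λ i<i′ _ → s≤s z≤n , s≤s (ℕₚ.+-monoʳ-< s i<i′) , λ _ → tt))

  flat-before : ∀ {t} d → suc t < proj₁ d → Compatible (suc t , flat) d
  flat-before _ t<i′ = s≤s z≤n , t<i′ , λ _ → tt

  middle-index : ∀ {p} d → Middle p d → l ≤ proj₁ d
  middle-index (i , mover _ _) (l≤i , _) = l≤i

  middle-before-high : ∀ d → Middle j d → ∀ t → Compatible d (suc k + t , flat)
  middle-before-high (i , mover _ _) (l≤i , i<k , _) t =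
    ℕₚ.≤-trans (s≤s z≤n) l≤i , ℕₚ.<-≤-trans i<k (ℕₚ.≤-trans (ℕₚ.n≤1+n k) (ℕₚ.m≤m+n (suc k) t)) ,
    λ eq → ⊥-elim (ℕₚ.<-irrefl (≡.sym eq) (s≤s (ℕₚ.<-≤-trans i<k (ℕₚ.m≤m+n k t))))

  family-pairwise : ∀ {cap c} → Admissible j cap c → AllPairs Compatible (family c)
  family-pairwise {c = c} adm =
    AllPairsₚ.++⁺ (flats-pairwise 0 l₀) (AllPairsₚ.++⁺ (movers-pairwise adm) (flats-pairwise k m) middle-then-high)
                  low-then-rest
    where
    middle-then-high : All (λ d → All (Compatible d) (flats (suc k) m)) (movers l c)
    middle-then-high = All.map (λ {d} mid → flats-all (suc k) m (λ t _ → middle-before-high d mid t)) (movers-middle adm)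
    low-then-rest : All (λ d → All (Compatible d) (movers l c ++ flats (suc k) m)) (flats 1 l₀)
    low-then-rest = flats-all 1 l₀ (λ t t<l₀ → Allₚ.++⁺
      (All.map (λ {d} mid → flat-before d (ℕₚ.<-≤-trans (s≤s t<l₀) (middle-index d mid))) (movers-middle adm))
      (flats-all (suc k) m (λ t′ _ → flat-before (suc k + t′ , flat)
        (ℕₚ.<-trans (s≤s t<l₀) (ℕₚ.≤-<-trans (ℕₚ.m≤m+n l j) (ℕₚ.m≤m+n (suc k) t′))))))

  family-paths : ∀ {cap c} → Admissible j cap c → All (λ d → PathAt (proj₁ d) (uncurry draw d)) (family c)
  family-paths adm = Allₚ.++⁺ (flats-all 1 l₀ (λ t t<l₀ → low t (s≤s t<l₀)))
    (Allₚ.++⁺ (All.map (λ {d} → middle d) (movers-middle adm))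
              (flats-all (suc k) m (λ t _ → high (s≤s (ℕₚ.m≤m+n k t)))))
    where
    low : ∀ t → suc t < l → PathAt (suc t) (flatPath (suc t))
    low t t<l = ≡.subst (λ s → IsPath s (B (suc t)) (flatPath (suc t))) (≡.sym (src-below t<l)) (flat-isPath (s≤s z≤n))
    high : ∀ {i} → k < i → PathAt i (flatPath i)
    high {suc i} k<i = ≡.subst (λ s → IsPath s (B (suc i)) (flatPath (suc i)))
          (≡.sym (src-above k<i)) (flat-isPath (s≤s z≤n))
    middle : ∀ d → Middle j d → PathAt (proj₁ d) (uncurry draw d)
    middle (i , mover a b) (l≤i , i<k , a≤b , b<i) =
      ≡.subst (λ s → IsPath s (B i) (moverPath i a b)) (≡.sym (src-between l≤i i<k)) (mover-isPath a≤b b<i)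

  encode-InΓ : ∀ {cap c} → Admissible j cap c → InΓ n k l (encode c)
  encode-InΓ {c = c} adm =
    ≡.subst (λ I → Pointwise PathAt I (encode c)) (family-indices c (admissible-length adm))
            (Pointwise-map⁺ proj₁ (uncurry draw) (family-paths adm)) ,
    AllPairsₚ.map⁺ (AllPairs.map (λ {d} {d′} → disjoint d d′) (family-pairwise adm))
    where
    disjoint : ∀ d d′ → Compatible d d′ → Disjoint (uncurry draw d) (uncurry draw d′)
    disjoint (i , s) (i′ , s′) (1≤i , i<i′ , stacks) = draws-disjoint 1≤i i<i′ stacks

  encode-split : ∀ c → encode c ≡
                 map flatPath (range 1 l₀) ++ map (uncurry draw) (movers l c) ++ map flatPath (range (suc k) m)
  encode-split c = ≡.trans (Listₚ.map-++ (uncurry draw) (flats 1 l₀) _)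
    (≡.cong₂ _++_ (≡.sym (Listₚ.map-∘ (range 1 l₀)))
                  (≡.trans (Listₚ.map-++ (uncurry draw) (movers l c) _)
                      (≡.cong (map (uncurry draw) (movers l c) ++_) (≡.sym (Listₚ.map-∘ (range (suc k) m))))))

  lastPair : List (ℕ × ℕ) → ℕ × ℕ
  lastPair [] = 0 , 0
  lastPair (x ∷ []) = x
  lastPair (_ ∷ y ∷ c) = lastPair (y ∷ c)

  lastPair-∷ʳ : ∀ c x → lastPair (c ∷ʳ x) ≡ x
  lastPair-∷ʳ [] x = ≡.refl
  lastPair-∷ʳ (y ∷ []) x = ≡.refl
  lastPair-∷ʳ (y ∷ z ∷ c) x = lastPair-∷ʳ (z ∷ c) x

  lastPair-bound : ∀ {p cap c} → Admissible p cap c → proj₁ (lastPair c) ≤ l + p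
  lastPair-bound [] = z≤n
  lastPair-bound {suc p} (extend {a = a} {b = b} {c = c} _ a≤b b<l+p _) rewrite lastPair-∷ʳ c (a , b) =
    ℕₚ.≤-trans a≤b (ℕₚ.≤-trans (ℕₚ.<⇒≤ b<l+p) (ℕₚ.+-monoʳ-≤ l (ℕₚ.n≤1+n p)))

  draw-movers-∷ʳ : ∀ {p cap c} a b → Admissible p cap c →
                   map (uncurry draw) (movers l (c ∷ʳ (a , b))) ≡ map (uncurry draw) (movers l c) ∷ʳ moverPath (l + p) a b
  draw-movers-∷ʳ {c = c} a b adm rewrite movers-∷ʳ l c a b | admissible-length adm = Listₚ.map-++ (uncurry draw) (movers l c) _

  stacked-on : ∀ {p cap c a b} → Admissible p cap c → a ≤ b →
               All (λ v → All (Disjoint v) (moverPath (l + p) a b ∷ [])) (map (uncurry draw) (movers l c))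
                   → proj₁ (lastPair c) ≤ b
  stacked-on [] _ _ = z≤n
  stacked-on {suc p} {a = a} {b} (extend {a = a′} {b = b′} {c = c} _ _ _ adm) a≤b disjoint
    rewrite draw-movers-∷ʳ a′ b′ adm | lastPair-∷ʳ c (a′ , b′) with Allₚ.∷ʳ⁻ disjoint
  ... | _ , last ∷ [] = stacked-if-disjoint (ℕₚ.≤-trans (s≤s z≤n) (ℕₚ.m≤m+n l p)) a≤b
        (≡.subst (λ i → Disjoint (moverPath (l + p) a′ b′) (moverPath i a b)) (ℕₚ.+-suc l p) last)

  decode-movers : ∀ p {γ} → p ≤ j → Pointwise PathAt (range l p) γ → AllPairs Disjoint γ →
                  Σ[ c ∈ List (ℕ × ℕ) ] Admissible p (proj₁ (lastPair c)) c × γ ≡ map (uncurry draw) (movers l c)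
  decode-movers zero _ [] [] = [] , [] , ≡.refl
  decode-movers (suc p) {γ} p<j paths disjoint
    with Pointwise-++⁻ (range l p) (l + p ∷ [])
          (≡.subst (λ I → Pointwise PathAt I γ) (≡.sym (Listₚ.applyUpTo-∷ʳ _ p)) paths)
  ... | γ′ , w ∷ [] , ≡.refl , paths′ , path ∷ [] with AllPairs-++⁻ γ′ disjoint
  ... | disjoint′ , _ , across
    with decode-movers p (ℕₚ.<⇒≤ p<j) paths′ disjoint′
       | mover-unique (ℕₚ.≤-trans (s≤s z≤n) (ℕₚ.m≤m+n l p))
           (≡.subst (λ s → IsPath s (B (l + p)) w) (src-between (ℕₚ.m≤m+n l p) (ℕₚ.+-monoʳ-< l p<j)) path)
  ... | c , adm , ≡.refl | a , b , a≤b , b<l+p , ≡.refl =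
    c ∷ʳ (a , b) ,
    ≡.subst (λ t → Admissible (suc p) t (c ∷ʳ (a , b))) (≡.cong proj₁ (≡.sym (lastPair-∷ʳ c (a , b))))
            (extend ℕₚ.≤-refl a≤b b<l+p (admissible-weaken (stacked-on adm a≤b across) adm)) ,
    ≡.sym (draw-movers-∷ʳ a b adm)

  flats-unique : ∀ s c {γ} → 1 ≤ s → (s + c ≤ l ⊎ k < s) →
                 Pointwise PathAt (range s c) γ → γ ≡ map flatPath (range s c)
  flats-unique s c 1≤s side paths = Pointwise-functional flatPath paths
      (λ {i} i∈ path → flat-unique (ℕₚ.≤-trans 1≤s (proj₁ (∈-range⁻ s c i∈)))
    (≡.subst (λ x → IsPath x (B i) _) (source side (∈-range⁻ s c i∈)) path))
    where
    source : ∀ {i} → (s + c ≤ l ⊎ k < s) → s ≤ i × i < s + c → src k l i ≡ A i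
    source (inj₁ s+c≤l) (_ , i<s+c) = src-below (ℕₚ.<-≤-trans i<s+c s+c≤l)
    source (inj₂ k<s) (s≤i , _) = src-above (ℕₚ.<-≤-trans k<s s≤i)

  decode : ∀ {γ} → InΓ n k l γ → Σ[ c ∈ List (ℕ × ℕ) ] Admissible j (l + j) c × γ ≡ encode c
  decode {γ} (paths , disjoint)
    with Pointwise-++⁻ (range 1 l₀) _ (≡.subst (λ I → Pointwise PathAt I γ) indices-split paths)
  ... | γ₁ , γ₂₃ , ≡.refl , paths₁ , paths₂₃ with Pointwise-++⁻ (range l j) (range (suc k) m) paths₂₃
  ... | γ₂ , γ₃ , ≡.refl , paths₂ , paths₃
    with decode-movers j ℕₚ.≤-refl paths₂ (proj₁ (AllPairs-++⁻ γ₂ (proj₁ (proj₂ (AllPairs-++⁻ γ₁ disjoint)))))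
  ... | c , adm , ≡.refl =
    c , admissible-weaken (lastPair-bound adm) adm ,
    ≡.sym (≡.trans (encode-split c)
          (≡.cong₂ _++_ (≡.sym (flats-unique 1 l₀ (s≤s z≤n) (inj₁ ℕₚ.≤-refl) paths₁))
                                                  (≡.cong (_ ++_) (≡.sym (flats-unique (suc k) m (s≤s z≤n) (inj₂ ℕₚ.≤-refl) paths₃)))))

  movers-injective : ∀ i c c′ → All (λ x → proj₁ x ≤ proj₂ x) c → All (λ x → proj₁ x ≤ proj₂ x) c′ →
                     map (uncurry draw) (movers i c) ≡ map (uncurry draw) (movers i c′) → c ≡ c′
  movers-injective i [] [] _ _ _ = ≡.refl
  movers-injective i ((a , b) ∷ c) ((a′ , b′) ∷ c′) (a≤b ∷ ordered) (a′≤b′ ∷ ordered′) eq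
    with mover-injective a≤b a′≤b′ (Listₚ.∷-injectiveˡ eq)
  ... | ≡.refl , ≡.refl = ≡.cong ((a , b) ∷_) (movers-injective (suc i) c c′ ordered ordered′ (Listₚ.∷-injectiveʳ eq))

  encode-injective : ∀ {cap cap′ c c′} → Admissible j cap c → Admissible j cap′ c′ →
                     encode c ≡ encode c′ → c ≡ c′
  encode-injective {c = c} {c′} adm adm′ eq = movers-injective l c c′ (admissible-ordered adm) (admissible-ordered adm′)
    (Listₚ.++-cancelʳ (map flatPath (range (suc k) m)) _ _
      (Listₚ.++-cancelˡ (map flatPath (range 1 l₀)) _ _
            (≡.trans (≡.sym (encode-split c)) (≡.trans eq (encode-split c′)))))

  weight : List (ℕ × ℕ) → ℕ
  weight c = sum (map (λ x → proj₁ x + proj₂ x) c)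

  area : List (List Point) → ℕ
  area γ = sum (map lam γ)

  area-++ : ∀ γ γ′ → area (γ ++ γ′) ≡ area γ + area γ′
  area-++ γ γ′ = ≡.trans (≡.cong sum (Listₚ.map-++ lam γ γ′)) (sum-++ (map lam γ) _)

  area-encode : ∀ {cap c} → Admissible j cap c → area (encode c) ≡ weight c
  area-encode {c = c} adm = begin
    area (encode c)
      ≡⟨ ≡.cong area (encode-split c) ⟩
    area (map flatPath (range 1 l₀) ++ map (uncurry draw) (movers l c) ++ map flatPath (range (suc k) m))
      ≡⟨ ≡.trans (area-++ (map flatPath (range 1 l₀)) _) (≡.cong (_ +_) (area-++ (map (uncurry draw) (movers l c)) _)) ⟩
    area (map flatPath (range 1 l₀)) + (area (map (uncurry draw) (movers l c)) + area (map flatPath (range (suc k) m)))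
      ≡⟨ ≡.cong₂ _+_ (flat-area (range 1 l₀))
            (≡.cong₂ _+_ (mover-area l c (admissible-ordered adm)) (flat-area (range (suc k) m))) ⟩
    0 + (weight c + 0)
      ≡⟨ ℕₚ.+-identityʳ (weight c) ⟩
    weight c ∎
    where
    open ≡.≡-Reasoning
    flat-area : ∀ is → area (map flatPath is) ≡ 0
    flat-area [] = ≡.refl
    flat-area (i ∷ is) = ≡.cong₂ _+_ (lam-flat i) (flat-area is)
    mover-area : ∀ i c → All (λ x → proj₁ x ≤ proj₂ x) c → area (map (uncurry draw) (movers i c)) ≡ weight c
    mover-area i [] [] = ≡.refl
    mover-area i ((a , b) ∷ c) (a≤b ∷ ordered) = ≡.cong₂ _+_ (lam-mover i a≤b) (mover-area (suc i) c ordered)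

module Enumeration {c ℓ : Level} (R : CommutativeRing c ℓ) (q : CommutativeRing.Carrier R) (l₀ j m : ℕ) where
  open CommutativeRing R hiding (zero)
  open WithRing R using (pow; sumList; ψ)
  open Summation R
  open QChains R q using (pairWeight; pairSum)
  open Families l₀ j m
  open AdmissibleSequences R q l using (capped; topped; total; capped-total)
  open import Relation.Binary.Reasoning.Setoid setoid

  admissibles : ℕ → ℕ → List (List (ℕ × ℕ))
  endingAt : ℕ → ℕ → List (List (ℕ × ℕ))
  endingWith : ℕ → ℕ → ℕ → List (List (ℕ × ℕ))
  admissibles zero cap = [] ∷ []
  admissibles (suc p) cap = concatMap (λ a → onlyIf (a ≤ᵇ cap) (endingAt p a)) (upTo (l ℕ.+ p))
  endingAt p a = concatMap (endingWith p a) (upTo (l ℕ.+ p))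
  endingWith p a b = onlyIf (a ≤ᵇ b) (map (_∷ʳ (a , b)) (admissibles p b))

  admissibles-sound : ∀ p cap {c} → c ∈ admissibles p cap → Admissible p cap c
  admissibles-sound zero cap (here ≡.refl) = []
  admissibles-sound (suc p) cap c∈ with ∈-concatMap⁻′ _ (upTo (l ℕ.+ p)) c∈
  ... | a , _ , c∈₁ with ∈-onlyIf⁻ (a ≤ᵇ cap) c∈₁
  ... | a≤cap , c∈₂ with ∈-concatMap⁻′ (endingWith p a) (upTo (l ℕ.+ p)) c∈₂
  ... | b , b∈ , c∈₃ with ∈-onlyIf⁻ (a ≤ᵇ b) c∈₃
  ... | a≤b , c∈₄ with ∈-map⁻ (_∷ʳ (a , b)) c∈₄
  ... | c′ , c′∈ , ≡.refl =
    extend (ℕₚ.≤ᵇ⇒≤ a cap a≤cap) (ℕₚ.≤ᵇ⇒≤ a b a≤b) (∈-upTo⁻ b∈) (admissibles-sound p b c′∈)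

  admissibles-complete : ∀ {p cap c} → Admissible p cap c → c ∈ admissibles p cap
  admissibles-complete [] = here ≡.refl
  admissibles-complete {suc p} (extend {a = a} {b = b} a≤cap a≤b b<l+p adm) =
    ∈-concatMap⁺ _ (lose (∈-upTo⁺ (ℕₚ.≤-<-trans a≤b b<l+p)) (∈-onlyIf⁺ (ℕₚ.≤⇒≤ᵇ a≤cap)
      (∈-concatMap⁺ (endingWith p a) (lose (∈-upTo⁺ b<l+p)
        (∈-onlyIf⁺ (ℕₚ.≤⇒≤ᵇ a≤b) (∈-map⁺ (_∷ʳ (a , b)) (admissibles-complete adm)))))))

  endingWith-last : ∀ p a b {c} → c ∈ endingWith p a b → lastPair c ≡ (a , b)
  endingWith-last p a b c∈ with ∈-map⁻ (_∷ʳ (a , b)) (proj₂ (∈-onlyIf⁻ (a ≤ᵇ b) c∈))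
  ... | c′ , _ , ≡.refl = lastPair-∷ʳ c′ (a , b)

  endingAt-last : ∀ p a {c} → c ∈ endingAt p a → proj₁ (lastPair c) ≡ a
  endingAt-last p a c∈ with ∈-concatMap⁻′ (endingWith p a) (upTo (l ℕ.+ p)) c∈
  ... | b , _ , c∈′ = ≡.cong proj₁ (endingWith-last p a b c∈′)

  admissibles-unique : ∀ p cap → Unique (admissibles p cap)
  endingAt-unique : ∀ p a → Unique (endingAt p a)
  admissibles-unique zero cap = [] ∷ []
  admissibles-unique (suc p) cap =
    concatMap-unique _ (λ c → proj₁ (lastPair c)) (Uniqueₚ.upTo⁺ (l ℕ.+ p))
      (λ a → onlyIf-unique (a ≤ᵇ cap) (endingAt-unique p a))
      (λ a c∈ → endingAt-last p a (proj₂ (∈-onlyIf⁻ (a ≤ᵇ cap) c∈)))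
  endingAt-unique p a =
    concatMap-unique (endingWith p a) (λ c → proj₂ (lastPair c)) (Uniqueₚ.upTo⁺ (l ℕ.+ p))
      (λ b → onlyIf-unique (a ≤ᵇ b) (Uniqueₚ.map⁺ (Listₚ.∷ʳ-injectiveˡ _ _) (admissibles-unique p b)))
      (λ b c∈ → ≡.cong proj₂ (endingWith-last p a b c∈))

  weigh : List (ℕ × ℕ) → Carrier
  weigh c = pow q (weight c)

  weigh-∷ʳ : ∀ c a b → weigh (c ∷ʳ (a , b)) ≈ pow q (a ℕ.+ b) * weigh c
  weigh-∷ʳ c a b = begin
    pow q (weight (c ∷ʳ (a , b)))
      ≡⟨ ≡.cong (pow q) (≡.trans (≡.cong sum (Listₚ.map-++ _ c _))
           (≡.trans (sum-++ (map _ c) _) (≡.cong (weight c ℕ.+_) (ℕₚ.+-identityʳ _)))) ⟩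
    pow q (weight c ℕ.+ (a ℕ.+ b))      ≈⟨ pow-+ q (weight c) _ ⟩
    pow q (weight c) * pow q (a ℕ.+ b)  ≈⟨ *-comm _ _ ⟩
    pow q (a ℕ.+ b) * weigh c           ∎

  admissibles-weight : ∀ p cap → sumList (map weigh (admissibles p cap)) ≈ capped p cap
  endingAt-weight : ∀ p a → sumList (map weigh (endingAt p a)) ≈ topped p a
  endingWith-weight : ∀ p a b → sumList (map weigh (endingWith p a b)) ≈ pairWeight a b * capped p b

  admissibles-weight zero cap = +-identityʳ 1#
  admissibles-weight (suc p) cap = begin
    sumList (map weigh (admissibles (suc p) cap))
      ≈⟨ trans (sumList-concatMap weigh (λ a → onlyIf (a ≤ᵇ cap) (endingAt p a)) (upTo (l ℕ.+ p)))
               (sumList-upTo (l ℕ.+ p) _) ⟩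
    ∑ (l ℕ.+ p) (λ a → sumList (map weigh (onlyIf (a ≤ᵇ cap) (endingAt p a))))
      ≈⟨ ∑-cong (l ℕ.+ p) (λ a _ → trans (sumList-onlyIf weigh (a ≤ᵇ cap) _) (*-congˡ (endingAt-weight p a))) ⟩
    ∑ (l ℕ.+ p) (λ a → ⟦ a ≤ᵇ cap ⟧ * topped p a) ∎

  endingAt-weight p a = trans (sumList-concatMap weigh (endingWith p a) (upTo (l ℕ.+ p)))
    (trans (sumList-upTo (l ℕ.+ p) _) (∑-cong (l ℕ.+ p) (λ b _ → endingWith-weight p a b)))

  endingWith-weight p a b = begin
    sumList (map weigh (endingWith p a b))
      ≈⟨ sumList-onlyIf weigh (a ≤ᵇ b) _ ⟩
    ⟦ a ≤ᵇ b ⟧ * sumList (map weigh (map (_∷ʳ (a , b)) (admissibles p b)))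
      ≡⟨ ≡.cong (λ xs → ⟦ a ≤ᵇ b ⟧ * sumList xs) (Listₚ.map-∘ (admissibles p b)) ⟨
    ⟦ a ≤ᵇ b ⟧ * sumList (map (λ c → weigh (c ∷ʳ (a , b))) (admissibles p b))
      ≈⟨ *-congˡ (trans (sumList-cong _ _ (admissibles p b) (λ {c} _ → weigh-∷ʳ c a b))
                        (sumList-*ˡ _ weigh (admissibles p b))) ⟩
    ⟦ a ≤ᵇ b ⟧ * (pow q (a ℕ.+ b) * sumList (map weigh (admissibles p b)))
      ≈⟨ trans (sym (*-assoc _ _ _)) (*-congˡ (admissibles-weight p b)) ⟩
    pairWeight a b * capped p b ∎

  families : List (List (List Point))
  families = map encode (admissibles j (l ℕ.+ j))

  families-unique : Unique families
  families-unique = map-unique-on encode (admissibles-unique j (l ℕ.+ j))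
    (λ c∈ c′∈ → encode-injective (admissibles-sound j _ c∈) (admissibles-sound j _ c′∈))

  ∈-families : ∀ {γ} → γ ∈ families ⇔ InΓ n k l γ
  ∈-families = mk⇔ to from
    where
    to : ∀ {γ} → γ ∈ families → InΓ n k l γ
    to γ∈ with ∈-map⁻ encode γ∈
    ... | c , c∈ , ≡.refl = encode-InΓ (admissibles-sound j _ c∈)
    from : ∀ {γ} → InΓ n k l γ → γ ∈ families
    from inΓ with decode inΓ
    ... | c , adm , ≡.refl = ∈-map⁺ encode (admissibles-complete adm)

  families-weight : sumList (map (ψ q) families) ≈ total j
  families-weight = begin
    sumList (map (ψ q) (map encode (admissibles j (l ℕ.+ j))))
      ≡⟨ ≡.cong sumList (Listₚ.map-∘ (admissibles j (l ℕ.+ j))) ⟨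
    sumList (map (λ c → ψ q (encode c)) (admissibles j (l ℕ.+ j)))
      ≈⟨ sumList-cong _ weigh _ (λ c∈ → reflexive (≡.cong (pow q) (area-encode (admissibles-sound j _ c∈)))) ⟩
    sumList (map weigh (admissibles j (l ℕ.+ j)))               ≈⟨ admissibles-weight j (l ℕ.+ j) ⟩
    capped j (l ℕ.+ j)                                          ≈⟨ capped-total j ⟩
    total j                                                     ∎

  Γ-weight : (Γ : List (List (List Point))) → Unique Γ → (∀ γ → (γ ∈ Γ) ⇔ InΓ n k l γ) →
             sumList (map (ψ q) Γ) ≈ total j
  Γ-weight Γ unique members = trans (sumList-↭ (Permutationₚ.map⁺ (ψ q) Γ↭families)) families-weight
    where
    Γ↭families : Γ ↭ families
    Γ↭families = ∼bag⇒↭ (unique∧set⇒bag unique families-unique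
      (λ {γ} → mk⇔ (λ γ∈ → Equivalence.from ∈-families (Equivalence.to (members γ) γ∈))
                   (λ γ∈ → Equivalence.from (members γ) (Equivalence.to ∈-families γ∈))))

Γ-total : ∀ {c ℓ} (R : CommutativeRing c ℓ) q l₀ {n k} → suc l₀ ≤ k → k ≤ n →
          (Γ : List (List (List Point))) → Unique Γ → (∀ γ → (γ ∈ Γ) ⇔ InΓ n k (suc l₀) γ) →
          CommutativeRing._≈_ R (WithRing.sumList R (map (WithRing.ψ R q) Γ))
                                (AdmissibleSequences.total R q (suc l₀) (k ∸ suc l₀))
Γ-total R q l₀ l≤k k≤n = split (ℕₚ.m+[n∸m]≡n l≤k) (ℕₚ.m+[n∸m]≡n k≤n)
  where
  open CommutativeRing R using (trans; reflexive)
  split : ∀ {n k j m} → suc l₀ ℕ.+ j ≡ k → k ℕ.+ m ≡ n →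
          ∀ Γ → Unique Γ → (∀ γ → (γ ∈ Γ) ⇔ InΓ n k (suc l₀) γ) →
          CommutativeRing._≈_ R (WithRing.sumList R (map (WithRing.ψ R q) Γ))
                                (AdmissibleSequences.total R q (suc l₀) (k ∸ suc l₀))
  split {j = j} {m} ≡.refl ≡.refl Γ unique members =
    trans (Enumeration.Γ-weight R q l₀ j m Γ unique members)
          (reflexive (≡.cong (AdmissibleSequences.total R q (suc l₀)) (≡.sym (ℕₚ.m+n∸m≡n (suc l₀) j))))

theorem5 : ∀ {c ℓ} (R : CommutativeRing c ℓ) (q : CommutativeRing.Carrier R)
           (n k l : ℕ) → 1 ≤ l → l ≤ k → k ≤ n →
           (H : ℕ → ℕ → CommutativeRing.Carrier R) → WithRing.IsInverseG R q H →
           (Γ : List (List (List Point))) → Unique Γ →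
           (∀ γ → (γ ∈ Γ) ⇔ InΓ n k l γ) →
           CommutativeRing._≈_ R (WithRing.signed R (k ∸ l) (H k l))
             (WithRing.sumList R (map (WithRing.ψ R q) Γ))
theorem5 R q n k (suc l₀) _ l≤k k≤n H inverse Γ unique members = begin
  signed (k ∸ suc l₀) (H k (suc l₀))  ≈⟨ InverseColumn.signed-H≈total R q l₀ H inverse k l≤k ⟩
  total (k ∸ suc l₀)                  ≈⟨ Γ-total R q l₀ l≤k k≤n Γ unique members ⟨
  sumList (map (ψ q) Γ)               ∎
  where
  open CommutativeRing R using (setoid)
  open WithRing R using (signed; sumList; ψ)
  open AdmissibleSequences R q (suc l₀) using (total)
  open import Relation.Binary.Reasoning.Setoid setoid
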